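{- Let $N$ be a positive integer, $E_1,E_2\subseteq\mathbb{Z}_N$ with $|E_1|=\beta_1N$, $|E_2|=\beta_2N$, and let $A\subseteq E_1\times E_2$ with $|A|=\delta|E_1||E_2|$, $\delta>0$. Suppose: $E_1$ and $E_2$ are $10^{ -330}\beta_1^{24}\beta_2^{24}\delta^{132}$-uniform; $A$ is $\alpha$-uniform with respect to the basis $(\vec e_1,\vec e_2)$, where $\alpha=10^{ -108}\delta^{44}$; $N\ge10^{10}(\delta^4\beta_1\beta_2)^{ -1}$; and $\sum_{y\in E_2}|\delta_y-\delta|^2\le\alpha\beta_2N$. Then $A$ contains a corner, i.e. there are $(a,b)\in\mathbb{Z}_N^2$ and $d\in\mathbb{Z}_N\setminus\{0\}$ with $(a,b),(a+d,b),(a,b+d)\in A$.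
   Context: A set $E\subseteq\mathbb{Z}_N$ with $|E|=\beta N$ is $\gamma$-uniform if $\phi=\chi_E-\beta$ satisfies $\sum_{k\in\mathbb{Z}_N}\big|\sum_{s}\phi(s)\overline{\phi(s-k)}\big|^2\le\gamma N^3$. For $A\subseteq E_1\times E_2$ and $y\in\mathbb{Z}_N$ let $\delta_y=\frac{1}{|E_1|}|\{x\in E_1:(x,y)\in A\}|$, and let the balanced function of $A$ be $f(x,y)=(\chi_A(x,y)-\delta_y)\chi_{E_1\times E_2}(x,y)$. $A$ is $\alpha$-uniform with respect to the basis $(\vec e_1,\vec e_2)$ (where $\vec e_1=(1,0)$, $\vec e_2=(0,-1)$) if $\sum_{y,y'\in\mathbb{Z}_N}\big|\sum_{x\in\mathbb{Z}_N}f(x,y)\overline{f(x,y')}\big|^2\le\alpha|E_1|^2|E_2|^2$. -}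

module Defs where

open import Data.Nat as ℕ using (ℕ; zero; suc; NonZero)
open import Data.Nat.DivMod using (_%_; m%n<n)
open import Data.Fin as F using (Fin; toℕ; fromℕ<)
open import Data.Bool using (_∧_)
open import Data.Product using (∃; _×_)
open import Relation.Binary.PropositionalEquality using (_≡_; _≢_)
import Data.Rational as Q
open import Data.Bool using (Bool; true; false)
open import Data.Integer using (+_)
open import Data.Rational using (ℚ; 0ℚ; 1ℚ; _+_; _*_; _-_; _/_)

-- ℤ_N is modelled as Fin N (N positive), with arithmetic mod N.
module _ (N : ℕ) .{{_ : NonZero N}} where
  _+ₙ_ : Fin N → Fin N → Fin N
  a +ₙ b = fromℕ< (m%n<n (toℕ a ℕ.+ toℕ b) N)

  _-ₙ_ : Fin N → Fin N → Fin N
  a -ₙ b = fromℕ< (m%n<n (toℕ a ℕ.+ (N ℕ.∸ toℕ b)) N)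

_^ℚ_ : ℚ → ℕ → ℚ
q ^ℚ zero = 1ℚ
q ^ℚ suc n = q * (q ^ℚ n)

Σ : (n : ℕ) → (Fin n → ℚ) → ℚ
Σ zero f = 0ℚ
Σ (suc n) f = f F.zero + Σ n (λ i → f (F.suc i))

χ : Bool → ℚ
χ true = 1ℚ
χ false = 0ℚ

ι : ℕ → ℚ
ι n = + n / 1

card : (n : ℕ) → (Fin n → Bool) → ℕ
card zero P = 0
card (suc n) P with P F.zero
... | true = suc (card n (λ i → P (F.suc i)))
... | false = card n (λ i → P (F.suc i))

-- c / d as a rational (with the irrelevant convention c / 0 = 0)
frac : ℕ → ℕ → ℚ
frac c zero = 0ℚ
frac c (suc d) = + c / suc d

tenNeg : ℕ → ℚ
tenNeg k = frac 1 (10 ℕ.^ k)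

sq : ℚ → ℚ
sq q = q * q

module _ (N : ℕ) .{{_ : NonZero N}} where
  IsUniformSet : (Fin N → Bool) → ℚ → Set
  IsUniformSet E γ =
    Σ N (λ k → sq (Σ N (λ s → φ s * φ (_-ₙ_ N s k))))
      Q.≤ γ * ι (N ℕ.^ 3)
    where
      β : ℚ
      β = frac (card N E) N
      φ : Fin N → ℚ
      φ s = χ (E s) - β

  δ-row : (Fin N → Bool) → (Fin N → Fin N → Bool) → Fin N → ℚ
  δ-row E₁ A y = frac (card N (λ x → E₁ x ∧ A x y)) (card N E₁)

  balanced : (Fin N → Bool) → (Fin N → Bool) → (Fin N → Fin N → Bool) →
             Fin N → Fin N → ℚ
  balanced E₁ E₂ A x y =
    (χ (A x y) - δ-row E₁ A y) * χ (E₁ x ∧ E₂ y)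

  IsUniformWrtBasis : (Fin N → Bool) → (Fin N → Bool) →
                      (Fin N → Fin N → Bool) → ℚ → Set
  IsUniformWrtBasis E₁ E₂ A α =
    Σ N (λ y → Σ N (λ y′ → sq (Σ N (λ x → f x y * f x y′))))
      Q.≤ α * sq (ι (card N E₁)) * sq (ι (card N E₂))
    where
      f = balanced E₁ E₂ A

  HasCorner : (Fin N → Fin N → Bool) → Set
  HasCorner A =
    ∃ λ a → ∃ λ b → ∃ λ d →
      (toℕ d ≢ 0) × (A a b ≡ true) × (A (_+ₙ_ N a d) b ≡ true)
        × (A a (_+ₙ_ N b d) ≡ true)

Σℕ : (n : ℕ) → (Fin n → ℕ) → ℕ
Σℕ zero f = 0
Σℕ (suc n) f = f F.zero ℕ.+ Σℕ n (λ i → f (F.suc i))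

card₂ : (n : ℕ) → (Fin n → Fin n → Bool) → ℕ
card₂ n A = Σℕ n (λ x → card n (A x))

module Submission where

-- Corners are counted by Λ F = Σ_{x,y,d} F(x,y) χ_A(x+d,y) χ_A(x,y+d).  If A has no corner only
-- d = 0 contributes, so Λ χ_A = |A|.  Split χ_A = f + h + δ χ_{E₁×E₂}, with f the balanced function
-- of A and h(x,y) = (δ_y − δ) χ_{E₁×E₂}(x,y).  The last term contributes δP, where
-- P = Σ_s (number of points of A on the line x + y = s)² ≥ |A|²/N by Cauchy–Schwarz.  The other two
-- terms are each at least −δP/4: two applications of Cauchy–Schwarz give (Λ F)⁴ ≤ |A|² P Q(F), and
-- Q(F) is small because F has small box norm (the α-uniformity of A for f, the bound on
-- Σ_y (δ_y − δ)² for h) while E₁ and E₂ have small autocorrelations.  Hence |A| ≥ δP/2 ≥ δ|A|²/(2N),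
-- i.e. δ²β₁β₂N ≤ 2, which contradicts N ≥ 10¹⁰(δ⁴β₁β₂)⁻¹.

open import Defs
open import Data.Nat using (ℕ; NonZero; _^_)
open import Data.Fin using (Fin)
open import Data.Bool using (Bool; true; false; _∧_)
open import Data.Product using (_×_; _,_; proj₁; proj₂)
open import Data.Rational using (ℚ; 0ℚ; _+_; _*_; _-_; _≤_; _<_)
open import Relation.Binary.PropositionalEquality using (_≡_)

open import Level using (0ℓ)
open import Function using (_∘_)
open import Data.Empty using (⊥; ⊥-elim)
open import Data.Sum using (inj₁; inj₂)
open import Relation.Nullary using (¬_; yes; no)
open import Relation.Nullary.Decidable using (Dec; dec⇒maybe; from-yes; decidable-stable; ¬?; _×-dec_)
open import Relation.Binary.PropositionalEquality
  using (_≢_; refl; sym; trans; cong; cong₂; subst; subst₂; isEquivalence; module ≡-Reasoning)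
open import Data.Nat as ℕ using (zero; suc)
import Data.Nat.Properties as ℕ
open import Data.Nat.DivMod using (_%_; %-distribˡ-+; m%n%n≡m%n; m<n⇒m%n≡m; n%n≡0)
import Data.Bool.Properties as Bool
open import Data.Fin as Fin using (toℕ; fromℕ<)
open import Data.Fin.Properties using (toℕ-fromℕ<; toℕ-injective; toℕ<n; toℕ≤n; suc-injective; any?)
open import Data.Fin.Permutation using (Permutation; _⟨$⟩ʳ_; permutation)
import Data.Integer as ℤ
import Data.Integer.Properties as ℤ
open import Data.Rational using (1ℚ; ½; -_; _/_; fromℚᵘ; toℚᵘ; positive; nonNegative; nonPositive)
open import Data.Rational.Properties
import Data.Rational.Unnormalised as ℚᵘ
import Data.Rational.Unnormalised.Properties as ℚᵘ
open import Algebra.Bundles using (Ring; AbelianGroup)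
import Algebra.Properties.AbelianGroup as AbelianGroupProperties
import Algebra.Properties.Semiring.Sum (Ring.semiring +-*-ring) as Sum
open import Tactic.RingSolver using (solve-∀)
open import Tactic.RingSolver.Core.AlmostCommutativeRing using (AlmostCommutativeRing; fromCommutativeRing)
open import Data.Rational.Solver using (module +-*-Solver)
open +-*-Solver using (solve; _:=_; _:+_; _:*_; _:^_; con)

-- Rational arithmetic

-- Identities are proved with solve-∀ ℚ-ring, except those involving _^ℚ_, which solve-∀ cannot see
-- through; for these Data.Rational.Solver is used, whose _:^_ unfolds exactly like _^ℚ_.
ℚ-ring : AlmostCommutativeRing 0ℓ 0ℓ
ℚ-ring = fromCommutativeRing +-*-commutativeRing (λ x → dec⇒maybe (0ℚ ≟ x))

fromℚᵘ-homo-+ : ∀ p q → fromℚᵘ (p ℚᵘ.+ q) ≡ fromℚᵘ p + fromℚᵘ q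
fromℚᵘ-homo-+ p q = toℚᵘ-injective (begin
  toℚᵘ (fromℚᵘ (p ℚᵘ.+ q))             ≈⟨ toℚᵘ-fromℚᵘ (p ℚᵘ.+ q) ⟩
  p ℚᵘ.+ q                              ≈⟨ ℚᵘ.+-cong (toℚᵘ-fromℚᵘ p) (toℚᵘ-fromℚᵘ q) ⟨
  toℚᵘ (fromℚᵘ p) ℚᵘ.+ toℚᵘ (fromℚᵘ q)  ≈⟨ toℚᵘ-homo-+ (fromℚᵘ p) (fromℚᵘ q) ⟨
  toℚᵘ (fromℚᵘ p + fromℚᵘ q)            ∎)
  where open ℚᵘ.≃-Reasoning

fromℚᵘ-homo-* : ∀ p q → fromℚᵘ (p ℚᵘ.* q) ≡ fromℚᵘ p * fromℚᵘ q
fromℚᵘ-homo-* p q = toℚᵘ-injective (begin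
  toℚᵘ (fromℚᵘ (p ℚᵘ.* q))             ≈⟨ toℚᵘ-fromℚᵘ (p ℚᵘ.* q) ⟩
  p ℚᵘ.* q                              ≈⟨ ℚᵘ.*-cong (toℚᵘ-fromℚᵘ p) (toℚᵘ-fromℚᵘ q) ⟨
  toℚᵘ (fromℚᵘ p) ℚᵘ.* toℚᵘ (fromℚᵘ q)  ≈⟨ toℚᵘ-homo-* (fromℚᵘ p) (fromℚᵘ q) ⟨
  toℚᵘ (fromℚᵘ p * fromℚᵘ q)            ∎)
  where open ℚᵘ.≃-Reasoning

-- ι n and frac c (suc d) are by definition fromℚᵘ (mkℚᵘ (+ n) 0) and fromℚᵘ (mkℚᵘ (+ c) d).
ι-+ : ∀ m n → ι (m ℕ.+ n) ≡ ι m + ι n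
ι-+ m n = trans (fromℚᵘ-cong {ℚᵘ.mkℚᵘ (ℤ.+ (m ℕ.+ n)) 0} {mᵘ ℚᵘ.+ nᵘ} (ℚᵘ.*≡* eq)) (fromℚᵘ-homo-+ mᵘ nᵘ)
  where
  mᵘ = ℚᵘ.mkℚᵘ (ℤ.+ m) 0
  nᵘ = ℚᵘ.mkℚᵘ (ℤ.+ n) 0
  eq : ℤ.+ (m ℕ.+ n) ℤ.* ℤ.+ 1 ≡ (ℤ.+ m ℤ.* ℤ.+ 1 ℤ.+ ℤ.+ n ℤ.* ℤ.+ 1) ℤ.* ℤ.+ 1
  eq = cong (ℤ._* ℤ.+ 1) (trans (ℤ.pos-+ m n) (sym (cong₂ ℤ._+_ (ℤ.*-identityʳ (ℤ.+ m)) (ℤ.*-identityʳ (ℤ.+ n)))))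

ι-* : ∀ m n → ι (m ℕ.* n) ≡ ι m * ι n
ι-* m n = trans (fromℚᵘ-cong {ℚᵘ.mkℚᵘ (ℤ.+ (m ℕ.* n)) 0} {mᵘ ℚᵘ.* nᵘ} (ℚᵘ.*≡* eq)) (fromℚᵘ-homo-* mᵘ nᵘ)
  where
  mᵘ = ℚᵘ.mkℚᵘ (ℤ.+ m) 0
  nᵘ = ℚᵘ.mkℚᵘ (ℤ.+ n) 0
  eq : ℤ.+ (m ℕ.* n) ℤ.* ℤ.+ 1 ≡ (ℤ.+ m ℤ.* ℤ.+ n) ℤ.* ℤ.+ 1
  eq = cong (ℤ._* ℤ.+ 1) (ℤ.pos-* m n)

frac*ι : ∀ c n .{{_ : NonZero n}} → frac c n * ι n ≡ ι c
frac*ι c (suc d) =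
  trans (sym (fromℚᵘ-homo-* cᵘ dᵘ)) (fromℚᵘ-cong {cᵘ ℚᵘ.* dᵘ} {ℚᵘ.mkℚᵘ (ℤ.+ c) 0} (ℚᵘ.*≡* eq))
  where
  cᵘ = ℚᵘ.mkℚᵘ (ℤ.+ c) d
  dᵘ = ℚᵘ.mkℚᵘ (ℤ.+ suc d) 0
  eq : (ℤ.+ c ℤ.* ℤ.+ suc d) ℤ.* ℤ.+ 1 ≡ ℤ.+ c ℤ.* (ℤ.+ suc d ℤ.* ℤ.+ 1)
  eq = ℤ.*-assoc (ℤ.+ c) (ℤ.+ suc d) (ℤ.+ 1)

0≤frac : ∀ c m → 0ℚ ≤ frac c m
0≤frac c zero = ≤-refl
0≤frac c (suc m) = nonNegative⁻¹ (frac c (suc m)) {{normalize-nonNeg c (suc m)}}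

0≤ι : ∀ n → 0ℚ ≤ ι n
0≤ι n = nonNegative⁻¹ (ι n) {{normalize-nonNeg n 1}}

2ℚ : ℚ
2ℚ = 1ℚ + 1ℚ

¼ : ℚ
¼ = ℤ.+ 1 / 4

0≤* : ∀ {p q} → 0ℚ ≤ p → 0ℚ ≤ q → 0ℚ ≤ p * q
0≤* {p} {q} 0≤p 0≤q =
  nonNegative⁻¹ _ {{nonNeg*nonNeg⇒nonNeg p {{nonNegative 0≤p}} q {{nonNegative 0≤q}}}}

0<* : ∀ {p q} → 0ℚ < p → 0ℚ < q → 0ℚ < p * q
0<* {p} {q} 0<p 0<q = positive⁻¹ _ {{pos*pos⇒pos p {{positive 0<p}} q {{positive 0<q}}}}

0≤sq : ∀ p → 0ℚ ≤ sq p
0≤sq p with ≤-total 0ℚ p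
... | inj₁ 0≤p = 0≤* 0≤p 0≤p
... | inj₂ p≤0 = nonNegative⁻¹ _ {{nonPos*nonPos⇒nonPos p {{nonPositive p≤0}} p {{nonPositive p≤0}}}}

*-monoˡ-≤ : ∀ {r p q} → 0ℚ ≤ r → p ≤ q → r * p ≤ r * q
*-monoˡ-≤ {r} 0≤r = *-monoˡ-≤-nonNeg r {{nonNegative 0≤r}}

*-monoʳ-≤ : ∀ {r p q} → 0ℚ ≤ r → p ≤ q → p * r ≤ q * r
*-monoʳ-≤ {r} 0≤r = *-monoʳ-≤-nonNeg r {{nonNegative 0≤r}}

*-mono-≤ : ∀ {p q r s} → 0ℚ ≤ p → 0ℚ ≤ r → p ≤ q → r ≤ s → p * r ≤ q * s
*-mono-≤ 0≤p 0≤r p≤q r≤s = ≤-trans (*-monoˡ-≤ 0≤p r≤s) (*-monoʳ-≤ (≤-trans 0≤r r≤s) p≤q)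

*-cancelʳ-≤ : ∀ {r p q} → 0ℚ < r → p * r ≤ q * r → p ≤ q
*-cancelʳ-≤ {r} 0<r = *-cancelʳ-≤-pos r {{positive 0<r}}

0<ι : ∀ n .{{_ : NonZero n}} → 0ℚ < ι n
0<ι n = positive⁻¹ (ι n) {{normalize-pos n 1}}

frac≤1 : ∀ c m → ι c ≤ ι m → frac c m ≤ 1ℚ
frac≤1 c zero c≤m = ≤ᵇ⇒≤ _
frac≤1 c (suc m) c≤m = *-cancelʳ-≤ (0<ι (suc m))
  (subst₂ _≤_ (sym (frac*ι c (suc m))) (sym (*-identityˡ (ι (suc m)))) c≤m)

0≤p-q⇒q≤p : ∀ {p q} → 0ℚ ≤ p - q → q ≤ p
0≤p-q⇒q≤p {p} {q} 0≤p-q = subst₂ _≤_ (+-identityˡ q) (lemma p q) (+-monoˡ-≤ q 0≤p-q)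
  where
  lemma : ∀ p q → p - q + q ≡ p
  lemma = solve-∀ ℚ-ring

q≤p⇒0≤p-q : ∀ {p q} → q ≤ p → 0ℚ ≤ p - q
q≤p⇒0≤p-q {p} {q} q≤p = subst (_≤ p - q) (+-inverseʳ q) (+-monoˡ-≤ (- q) q≤p)

sq-mono-≤ : ∀ {p q} → 0ℚ ≤ p → p ≤ q → sq p ≤ sq q
sq-mono-≤ 0≤p p≤q = *-mono-≤ 0≤p 0≤p p≤q p≤q

sq≤sq⇒≤ : ∀ {p q} → 0ℚ ≤ q → sq p ≤ sq q → p ≤ q
sq≤sq⇒≤ {p} {q} 0≤q p²≤q² with p ≤? q
... | yes p≤q = p≤q
... | no p≰q = ⊥-elim (<-irrefl refl (<-≤-trans q²<p² p²≤q²))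
  where
  q<p = ≰⇒> p≰q
  q²<p² : sq q < sq p
  q²<p² = ≤-<-trans (*-monoʳ-≤ 0≤q (<⇒≤ q<p)) (*-monoʳ-<-pos p {{positive (≤-<-trans 0≤q q<p)}} q<p)

sq≤sq⇒-≤ : ∀ {p q} → 0ℚ ≤ q → sq p ≤ sq q → - q ≤ p
sq≤sq⇒-≤ {p} {q} 0≤q p²≤q² =
  subst (- q ≤_) (neg-involutive p) (neg-antimono-≤ (sq≤sq⇒≤ 0≤q (subst (_≤ sq q) (sq-neg p) p²≤q²)))
  where
  sq-neg : ∀ p → p * p ≡ (- p) * (- p)
  sq-neg = solve-∀ ℚ-ring
  neg-involutive : ∀ p → - (- p) ≡ p
  neg-involutive = solve-∀ ℚ-ring

sq-diff≤1 : ∀ {p q} → 0ℚ ≤ p → p ≤ 1ℚ → 0ℚ ≤ q → q ≤ 1ℚ → sq (p - q) ≤ 1ℚ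
sq-diff≤1 {p} {q} 0≤p p≤1 0≤q q≤1 = 0≤p-q⇒q≤p (subst (0ℚ ≤_) (factor p q)
  (0≤* (+-mono-≤ (q≤p⇒0≤p-q p≤1) 0≤q) (+-mono-≤ (q≤p⇒0≤p-q q≤1) 0≤p)))
  where
  factor : ∀ p q → (1ℚ - p + q) * (1ℚ - q + p) ≡ 1ℚ - (p - q) * (p - q)
  factor = solve-∀ ℚ-ring

sq-+-≤ : ∀ p q → sq (p + q) ≤ 2ℚ * sq p + 2ℚ * sq q
sq-+-≤ p q = 0≤p-q⇒q≤p (subst (0ℚ ≤_) (identity p q) (0≤sq (p - q)))
  where
  identity : ∀ p q → (p - q) * (p - q) ≡ 2ℚ * (p * p) + 2ℚ * (q * q) - (p + q) * (p + q)
  identity = solve-∀ ℚ-ring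

^ℚ-nonNeg : ∀ {q} n → 0ℚ ≤ q → 0ℚ ≤ q ^ℚ n
^ℚ-nonNeg zero 0≤q = ≤ᵇ⇒≤ _
^ℚ-nonNeg (suc n) 0≤q = 0≤* 0≤q (^ℚ-nonNeg n 0≤q)

^ℚ-pos : ∀ {q} n → 0ℚ < q → 0ℚ < q ^ℚ n
^ℚ-pos zero 0<q = from-yes (0ℚ <? 1ℚ)
^ℚ-pos (suc n) 0<q = 0<* 0<q (^ℚ-pos n 0<q)

^ℚ-+ : ∀ q m n → q ^ℚ (m ℕ.+ n) ≡ q ^ℚ m * q ^ℚ n
^ℚ-+ q zero n = sym (*-identityˡ _)
^ℚ-+ q (suc m) n = trans (cong (q *_) (^ℚ-+ q m n)) (sym (*-assoc q _ _))

ι-^ : ∀ m n → ι (m ^ n) ≡ ι m ^ℚ n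
ι-^ m zero = refl
ι-^ m (suc n) = trans (ι-* m (m ^ n)) (cong (ι m *_) (ι-^ m n))

^ℚ-≤1 : ∀ {q} n → 0ℚ ≤ q → q ≤ 1ℚ → q ^ℚ n ≤ 1ℚ
^ℚ-≤1 zero 0≤q q≤1 = ≤-refl
^ℚ-≤1 (suc n) 0≤q q≤1 = *-mono-≤ 0≤q (^ℚ-nonNeg n 0≤q) q≤1 (^ℚ-≤1 n 0≤q q≤1)

^ℚ-antimono : ∀ {q m n} → m ℕ.≤ n → 0ℚ ≤ q → q ≤ 1ℚ → q ^ℚ n ≤ q ^ℚ m
^ℚ-antimono {q} {m} {n} m≤n 0≤q q≤1 = subst (λ k → q ^ℚ k ≤ q ^ℚ m) (ℕ.m+[n∸m]≡n m≤n) (begin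
  q ^ℚ (m ℕ.+ (n ℕ.∸ m))           ≡⟨ ^ℚ-+ q m (n ℕ.∸ m) ⟩
  q ^ℚ m * q ^ℚ (n ℕ.∸ m)          ≤⟨ *-monoˡ-≤ (^ℚ-nonNeg m 0≤q) (^ℚ-≤1 (n ℕ.∸ m) 0≤q q≤1) ⟩
  q ^ℚ m * 1ℚ                      ≡⟨ *-identityʳ _ ⟩
  q ^ℚ m                           ∎)
  where open ≤-Reasoning

^ℚ-mono-≤ : ∀ {p q} n → 0ℚ ≤ p → p ≤ q → p ^ℚ n ≤ q ^ℚ n
^ℚ-mono-≤ zero 0≤p p≤q = ≤-refl
^ℚ-mono-≤ (suc n) 0≤p p≤q = *-mono-≤ 0≤p (^ℚ-nonNeg n 0≤p) p≤q (^ℚ-mono-≤ n 0≤p p≤q)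

-- Finite sums and the Cauchy–Schwarz inequality

Σ≡sum : ∀ n (f : Fin n → ℚ) → Σ n f ≡ Sum.sum f
Σ≡sum zero f = refl
Σ≡sum (suc n) f = cong (f Fin.zero +_) (Σ≡sum n (f ∘ Fin.suc))

Σ-cong : ∀ n {f g : Fin n → ℚ} → (∀ i → f i ≡ g i) → Σ n f ≡ Σ n g
Σ-cong zero f≗g = refl
Σ-cong (suc n) f≗g = cong₂ _+_ (f≗g Fin.zero) (Σ-cong n (f≗g ∘ Fin.suc))

Σ-distrib-+ : ∀ n (f g : Fin n → ℚ) → Σ n (λ i → f i + g i) ≡ Σ n f + Σ n g
Σ-distrib-+ n f g = begin
  Σ n (λ i → f i + g i)  ≡⟨ Σ≡sum n _ ⟩
  Sum.sum (λ i → f i + g i) ≡⟨ Sum.∑-distrib-+ f g ⟩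
  Sum.sum f + Sum.sum g  ≡⟨ cong₂ _+_ (Σ≡sum n f) (Σ≡sum n g) ⟨
  Σ n f + Σ n g          ∎
  where open ≡-Reasoning

*-distribˡ-Σ : ∀ n c (f : Fin n → ℚ) → Σ n (λ i → c * f i) ≡ c * Σ n f
*-distribˡ-Σ n c f = begin
  Σ n (λ i → c * f i)        ≡⟨ Σ≡sum n _ ⟩
  Sum.sum (λ i → c * f i)    ≡⟨ Sum.*-distribˡ-sum c f ⟨
  c * Sum.sum f              ≡⟨ cong (c *_) (Σ≡sum n f) ⟨
  c * Σ n f                  ∎
  where open ≡-Reasoning

Σ-permute : ∀ n (f : Fin n → ℚ) (π : Permutation n n) → Σ n (f ∘ (π ⟨$⟩ʳ_)) ≡ Σ n f
Σ-permute n f π = begin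
  Σ n (f ∘ (π ⟨$⟩ʳ_))        ≡⟨ Σ≡sum n _ ⟩
  Sum.sum (f ∘ (π ⟨$⟩ʳ_))    ≡⟨ Sum.sum-permute f π ⟨
  Sum.sum f                  ≡⟨ Σ≡sum n f ⟨
  Σ n f                      ∎
  where open ≡-Reasoning

Σ-const : ∀ n c → Σ n (λ _ → c) ≡ c * ι n
Σ-const zero c = sym (*-zeroʳ c)
Σ-const (suc n) c = begin
  c + Σ n (λ _ → c)   ≡⟨ cong (c +_) (Σ-const n c) ⟩
  c + c * ι n         ≡⟨ lemma c (ι n) ⟩
  c * (ι 1 + ι n)     ≡⟨ cong (c *_) (ι-+ 1 n) ⟨
  c * ι (suc n)       ∎
  where
  open ≡-Reasoning
  lemma : ∀ c x → c + c * x ≡ c * (1ℚ + x)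
  lemma = solve-∀ ℚ-ring

Σ-mono-≤ : ∀ n {f g : Fin n → ℚ} → (∀ i → f i ≤ g i) → Σ n f ≤ Σ n g
Σ-mono-≤ zero f≤g = ≤-refl
Σ-mono-≤ (suc n) f≤g = +-mono-≤ (f≤g Fin.zero) (Σ-mono-≤ n (f≤g ∘ Fin.suc))

Σ-single : ∀ n (f : Fin n → ℚ) j → (∀ i → i ≢ j → f i ≡ 0ℚ) → Σ n f ≡ f j
Σ-single (suc n) f Fin.zero f≡0 = begin
  f Fin.zero + Σ n (f ∘ Fin.suc)        ≡⟨ cong (f Fin.zero +_) (Σ-cong n (λ i → f≡0 (Fin.suc i) λ ())) ⟩
  f Fin.zero + Σ n (λ _ → 0ℚ)           ≡⟨ cong (f Fin.zero +_) (trans (Σ-const n 0ℚ) (*-zeroˡ (ι n))) ⟩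
  f Fin.zero + 0ℚ                       ≡⟨ +-identityʳ _ ⟩
  f Fin.zero                            ∎
  where open ≡-Reasoning
Σ-single (suc n) f (Fin.suc j) f≡0 = begin
  f Fin.zero + Σ n (f ∘ Fin.suc)        ≡⟨ cong (_+ Σ n (f ∘ Fin.suc)) (f≡0 Fin.zero λ ()) ⟩
  0ℚ + Σ n (f ∘ Fin.suc)                ≡⟨ +-identityˡ _ ⟩
  Σ n (f ∘ Fin.suc)                     ≡⟨ Σ-single n (f ∘ Fin.suc) j (λ i i≢j → f≡0 (Fin.suc i) (i≢j ∘ suc-injective)) ⟩
  f (Fin.suc j)                         ∎
  where open ≡-Reasoning

χ-nonNeg : ∀ b → 0ℚ ≤ χ b
χ-nonNeg true = ≤ᵇ⇒≤ _
χ-nonNeg false = ≤-refl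

χ-≤1 : ∀ b → χ b ≤ 1ℚ
χ-≤1 true = ≤-refl
χ-≤1 false = ≤ᵇ⇒≤ _

χ-idem : ∀ b → χ b * χ b ≡ χ b
χ-idem true = refl
χ-idem false = refl

χ-∧ : ∀ p q → χ (p ∧ q) ≡ χ p * χ q
χ-∧ true q = sym (*-identityˡ (χ q))
χ-∧ false q = sym (*-zeroˡ (χ q))

card≡Σχ : ∀ n (P : Fin n → Bool) → ι (card n P) ≡ Σ n (χ ∘ P)
card≡Σχ zero P = refl
card≡Σχ (suc n) P with P Fin.zero
... | true = trans (ι-+ 1 (card n (P ∘ Fin.suc))) (cong (1ℚ +_) (card≡Σχ n (P ∘ Fin.suc)))
... | false = trans (card≡Σχ n (P ∘ Fin.suc)) (sym (+-identityˡ _))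

ι-Σℕ : ∀ n (f : Fin n → ℕ) → ι (Σℕ n f) ≡ Σ n (ι ∘ f)
ι-Σℕ zero f = refl
ι-Σℕ (suc n) f = trans (ι-+ (f Fin.zero) _) (cong (ι (f Fin.zero) +_) (ι-Σℕ n (f ∘ Fin.suc)))

-- Iterated sums over Fin N, Fin N × Fin N, … share this interface, so Cauchy–Schwarz is proved once.
record Summation (I : Set) : Set where
  field
    ∑ : (I → ℚ) → ℚ
    ∑-cong : ∀ {f g} → (∀ i → f i ≡ g i) → ∑ f ≡ ∑ g
    ∑-distrib-+ : ∀ f g → ∑ (λ i → f i + g i) ≡ ∑ f + ∑ g
    *-distribˡ-∑ : ∀ c f → ∑ (λ i → c * f i) ≡ c * ∑ f
    ∑-mono-≤ : ∀ {f g} → (∀ i → f i ≤ g i) → ∑ f ≤ ∑ g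

Σ-summation : ∀ n → Summation (Fin n)
Σ-summation n = record
  { ∑ = Σ n
  ; ∑-cong = Σ-cong n
  ; ∑-distrib-+ = Σ-distrib-+ n
  ; *-distribˡ-∑ = *-distribˡ-Σ n
  ; ∑-mono-≤ = Σ-mono-≤ n
  }

infixr 5 _⊗_

_⊗_ : ∀ {I J} → Summation I → Summation J → Summation (I × J)
S ⊗ T = record
  { ∑ = λ f → S.∑ (λ i → T.∑ (λ j → f (i , j)))
  ; ∑-cong = λ f≗g → S.∑-cong (λ i → T.∑-cong (λ j → f≗g (i , j)))
  ; ∑-distrib-+ = λ f g → trans (S.∑-cong (λ i → T.∑-distrib-+ _ _)) (S.∑-distrib-+ _ _)
  ; *-distribˡ-∑ = λ c f → trans (S.∑-cong (λ i → T.*-distribˡ-∑ c _)) (S.*-distribˡ-∑ c _)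
  ; ∑-mono-≤ = λ f≤g → S.∑-mono-≤ (λ i → T.∑-mono-≤ (λ j → f≤g (i , j)))
  }
  where
  module S = Summation S
  module T = Summation T

module SummationProperties {I : Set} (S : Summation I) where
  open Summation S public

  ∑-zero : ∑ (λ _ → 0ℚ) ≡ 0ℚ
  ∑-zero = trans (∑-cong (λ _ → sym (*-zeroˡ 0ℚ))) (trans (*-distribˡ-∑ 0ℚ (λ _ → 0ℚ)) (*-zeroˡ (∑ (λ _ → 0ℚ))))

  ∑-nonNeg : ∀ {f} → (∀ i → 0ℚ ≤ f i) → 0ℚ ≤ ∑ f
  ∑-nonNeg {f} 0≤f = subst (_≤ ∑ f) ∑-zero (∑-mono-≤ 0≤f)

  *-distribʳ-∑ : ∀ c f → ∑ (λ i → f i * c) ≡ ∑ f * c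
  *-distribʳ-∑ c f = trans (∑-cong (λ i → *-comm (f i) c)) (trans (*-distribˡ-∑ c f) (*-comm c (∑ f)))

  ∑-linear₃ : ∀ a b c f g h →
              ∑ (λ i → a * f i + b * g i + c * h i) ≡ a * ∑ f + b * ∑ g + c * ∑ h
  ∑-linear₃ a b c f g h = begin
    ∑ (λ i → a * f i + b * g i + c * h i)               ≡⟨ ∑-distrib-+ _ _ ⟩
    ∑ (λ i → a * f i + b * g i) + ∑ (λ i → c * h i)     ≡⟨ cong₂ _+_ (∑-distrib-+ _ _) (*-distribˡ-∑ c h) ⟩
    ∑ (λ i → a * f i) + ∑ (λ i → b * g i) + c * ∑ h
      ≡⟨ cong (_+ c * ∑ h) (cong₂ _+_ (*-distribˡ-∑ a f) (*-distribˡ-∑ b g)) ⟩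
    a * ∑ f + b * ∑ g + c * ∑ h                         ∎
    where open ≡-Reasoning

  sq-∑ : ∀ f → sq (∑ f) ≡ ∑ (λ i → ∑ (λ j → f i * f j))
  sq-∑ f = trans (sym (*-distribʳ-∑ (∑ f) f)) (∑-cong (λ i → sym (*-distribˡ-∑ (f i) f)))

  Σ-comm-∑ : ∀ n (f : Fin n → I → ℚ) → Σ n (λ i → ∑ (f i)) ≡ ∑ (λ j → Σ n (λ i → f i j))
  Σ-comm-∑ zero f = sym ∑-zero
  Σ-comm-∑ (suc n) f = begin
    ∑ (f Fin.zero) + Σ n (λ i → ∑ (f (Fin.suc i)))          ≡⟨ cong (∑ (f Fin.zero) +_) (Σ-comm-∑ n (f ∘ Fin.suc)) ⟩
    ∑ (f Fin.zero) + ∑ (λ j → Σ n (λ i → f (Fin.suc i) j))  ≡⟨ ∑-distrib-+ _ _ ⟨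
    ∑ (λ j → Σ (suc n) (λ i → f i j))                       ∎
    where open ≡-Reasoning

  -- Lagrange's identity: Σᵢ Σⱼ wᵢ wⱼ (uᵢ vⱼ − uⱼ vᵢ)² = 2 (A C − B²).
  weighted-cauchy-schwarz : ∀ (w u v : I → ℚ) → (∀ i → 0ℚ ≤ w i) →
    sq (∑ (λ i → w i * (u i * v i))) ≤ ∑ (λ i → w i * sq (u i)) * ∑ (λ i → w i * sq (v i))
  weighted-cauchy-schwarz w u v 0≤w = *-cancelˡ-≤-pos 2ℚ (0≤p-q⇒q≤p (subst (0ℚ ≤_) lagrange 0≤double-sum))
    where
    A = ∑ (λ i → w i * sq (u i))
    B = ∑ (λ i → w i * (u i * v i))
    C = ∑ (λ i → w i * sq (v i))
    term : I → I → ℚ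
    term i j = w i * w j * sq (u i * v j - u j * v i)
    0≤double-sum : 0ℚ ≤ ∑ (λ i → ∑ (term i))
    0≤double-sum = ∑-nonNeg (λ i → ∑-nonNeg (λ j → 0≤* (0≤* (0≤w i) (0≤w j)) (0≤sq (u i * v j - u j * v i))))
    expand : ∀ wi wj ui uj vi vj →
      wi * wj * ((ui * vj - uj * vi) * (ui * vj - uj * vi)) ≡
      (wi * (ui * ui)) * (wj * (vj * vj)) + (- 2ℚ * (wi * (ui * vi))) * (wj * (uj * vj)) + (wi * (vi * vi)) * (wj * (uj * uj))
    expand = solve-∀ ℚ-ring
    regroup : ∀ a b c x y z → x * c + (- 2ℚ * y) * b + z * a ≡ c * x + (- 2ℚ * b) * y + a * z
    regroup = solve-∀ ℚ-ring
    collect : ∀ a b c → c * a + (- 2ℚ * b) * b + a * c ≡ 2ℚ * (a * c) - 2ℚ * (b * b)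
    collect = solve-∀ ℚ-ring
    lagrange : ∑ (λ i → ∑ (term i)) ≡ 2ℚ * (A * C) - 2ℚ * sq B
    lagrange = begin
      ∑ (λ i → ∑ (term i))
        ≡⟨ ∑-cong (λ i → trans (∑-cong (λ j → expand (w i) (w j) (u i) (u j) (v i) (v j)))
                                 (∑-linear₃ (w i * sq (u i)) (- 2ℚ * (w i * (u i * v i))) (w i * sq (v i))
                                            (λ j → w j * sq (v j)) (λ j → w j * (u j * v j)) (λ j → w j * sq (u j)))) ⟩
      ∑ (λ i → (w i * sq (u i)) * C + (- 2ℚ * (w i * (u i * v i))) * B + (w i * sq (v i)) * A)
        ≡⟨ ∑-cong (λ i → regroup A B C _ _ _) ⟩
      ∑ (λ i → C * (w i * sq (u i)) + (- 2ℚ * B) * (w i * (u i * v i)) + A * (w i * sq (v i)))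
        ≡⟨ ∑-linear₃ C (- 2ℚ * B) A (λ i → w i * sq (u i)) (λ i → w i * (u i * v i)) (λ i → w i * sq (v i)) ⟩
      C * A + (- 2ℚ * B) * B + A * C
        ≡⟨ collect A B C ⟩
      2ℚ * (A * C) - 2ℚ * sq B ∎
      where open ≡-Reasoning

  cauchy-schwarz : ∀ (u v : I → ℚ) →
    sq (∑ (λ i → u i * v i)) ≤ ∑ (λ i → sq (u i)) * ∑ (λ i → sq (v i))
  cauchy-schwarz u v = subst₂ _≤_
    (cong sq (∑-cong (λ i → *-identityˡ (u i * v i))))
    (cong₂ _*_ (∑-cong (λ i → *-identityˡ (sq (u i)))) (∑-cong (λ i → *-identityˡ (sq (v i)))))
    (weighted-cauchy-schwarz (λ _ → 1ℚ) u v (λ _ → ≤ᵇ⇒≤ _))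

  weighted-cauchy-schwarz′ : ∀ (w v : I → ℚ) → (∀ i → 0ℚ ≤ w i) →
    sq (∑ (λ i → w i * v i)) ≤ ∑ w * ∑ (λ i → w i * sq (v i))
  weighted-cauchy-schwarz′ w v 0≤w = subst₂ _≤_
    (cong sq (∑-cong (λ i → cong (w i *_) (*-identityˡ (v i)))))
    (cong (_* ∑ (λ i → w i * sq (v i))) (∑-cong (λ i → *-identityʳ (w i))))
    (weighted-cauchy-schwarz w (λ _ → 1ℚ) v 0≤w)

-- The cyclic group ℤ_N

module Cyclic (N : ℕ) .{{_ : NonZero N}} where

  infixl 6 _⊕_ _⊖_

  _⊕_ : Fin N → Fin N → Fin N
  _⊕_ = _+ₙ_ N

  _⊖_ : Fin N → Fin N → Fin N
  _⊖_ = _-ₙ_ N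

  0ₙ : Fin N
  0ₙ = fromℕ< (ℕ.>-nonZero⁻¹ N)

  neg : Fin N → Fin N
  neg a = 0ₙ ⊖ a

  toℕ-0ₙ : toℕ 0ₙ ≡ 0
  toℕ-0ₙ = toℕ-fromℕ< _

  private
    toℕ-⊕ : ∀ a b → toℕ (a ⊕ b) ≡ (toℕ a ℕ.+ toℕ b) % N
    toℕ-⊕ a b = toℕ-fromℕ< _

    toℕ-⊖ : ∀ a b → toℕ (a ⊖ b) ≡ (toℕ a ℕ.+ (N ℕ.∸ toℕ b)) % N
    toℕ-⊖ a b = toℕ-fromℕ< _

    [m%N+n]%N : ∀ m n → (m % N ℕ.+ n) % N ≡ (m ℕ.+ n) % N
    [m%N+n]%N m n = begin
      (m % N ℕ.+ n) % N          ≡⟨ %-distribˡ-+ (m % N) n N ⟩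
      (m % N % N ℕ.+ n % N) % N  ≡⟨ cong (λ k → (k ℕ.+ n % N) % N) (m%n%n≡m%n m N) ⟩
      (m % N ℕ.+ n % N) % N      ≡⟨ %-distribˡ-+ m n N ⟨
      (m ℕ.+ n) % N              ∎
      where open ≡-Reasoning

    [m+n%N]%N : ∀ m n → (m ℕ.+ n % N) % N ≡ (m ℕ.+ n) % N
    [m+n%N]%N m n = begin
      (m ℕ.+ n % N) % N  ≡⟨ cong (_% N) (ℕ.+-comm m (n % N)) ⟩
      (n % N ℕ.+ m) % N  ≡⟨ [m%N+n]%N n m ⟩
      (n ℕ.+ m) % N      ≡⟨ cong (_% N) (ℕ.+-comm n m) ⟩
      (m ℕ.+ n) % N      ∎
      where open ≡-Reasoning

  ⊕-assoc : ∀ a b c → (a ⊕ b) ⊕ c ≡ a ⊕ (b ⊕ c)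
  ⊕-assoc a b c = toℕ-injective (begin
    toℕ ((a ⊕ b) ⊕ c)                          ≡⟨ toℕ-⊕ (a ⊕ b) c ⟩
    (toℕ (a ⊕ b) ℕ.+ toℕ c) % N                ≡⟨ cong (λ k → (k ℕ.+ toℕ c) % N) (toℕ-⊕ a b) ⟩
    ((toℕ a ℕ.+ toℕ b) % N ℕ.+ toℕ c) % N      ≡⟨ [m%N+n]%N _ _ ⟩
    (toℕ a ℕ.+ toℕ b ℕ.+ toℕ c) % N            ≡⟨ cong (_% N) (ℕ.+-assoc (toℕ a) _ _) ⟩
    (toℕ a ℕ.+ (toℕ b ℕ.+ toℕ c)) % N          ≡⟨ [m+n%N]%N _ _ ⟨
    (toℕ a ℕ.+ (toℕ b ℕ.+ toℕ c) % N) % N      ≡⟨ cong (λ k → (toℕ a ℕ.+ k) % N) (toℕ-⊕ b c) ⟨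
    (toℕ a ℕ.+ toℕ (b ⊕ c)) % N                ≡⟨ toℕ-⊕ a (b ⊕ c) ⟨
    toℕ (a ⊕ (b ⊕ c))                          ∎)
    where open ≡-Reasoning

  ⊕-comm : ∀ a b → a ⊕ b ≡ b ⊕ a
  ⊕-comm a b = toℕ-injective (begin
    toℕ (a ⊕ b)                ≡⟨ toℕ-⊕ a b ⟩
    (toℕ a ℕ.+ toℕ b) % N      ≡⟨ cong (_% N) (ℕ.+-comm (toℕ a) (toℕ b)) ⟩
    (toℕ b ℕ.+ toℕ a) % N      ≡⟨ toℕ-⊕ b a ⟨
    toℕ (b ⊕ a)                ∎)
    where open ≡-Reasoning

  ⊕-identityʳ : ∀ a → a ⊕ 0ₙ ≡ a
  ⊕-identityʳ a = toℕ-injective (begin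
    toℕ (a ⊕ 0ₙ)                 ≡⟨ toℕ-⊕ a 0ₙ ⟩
    (toℕ a ℕ.+ toℕ 0ₙ) % N       ≡⟨ cong (λ k → (toℕ a ℕ.+ k) % N) toℕ-0ₙ ⟩
    (toℕ a ℕ.+ 0) % N            ≡⟨ cong (_% N) (ℕ.+-identityʳ (toℕ a)) ⟩
    toℕ a % N                    ≡⟨ m<n⇒m%n≡m (toℕ<n a) ⟩
    toℕ a                        ∎)
    where open ≡-Reasoning

  ⊖≡⊕neg : ∀ a b → a ⊖ b ≡ a ⊕ neg b
  ⊖≡⊕neg a b = toℕ-injective (begin
    toℕ (a ⊖ b)                                       ≡⟨ toℕ-⊖ a b ⟩
    (toℕ a ℕ.+ (N ℕ.∸ toℕ b)) % N                     ≡⟨ [m+n%N]%N _ _ ⟨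
    (toℕ a ℕ.+ (N ℕ.∸ toℕ b) % N) % N
      ≡⟨ cong (λ k → (toℕ a ℕ.+ (k ℕ.+ (N ℕ.∸ toℕ b)) % N) % N) toℕ-0ₙ ⟨
    (toℕ a ℕ.+ (toℕ 0ₙ ℕ.+ (N ℕ.∸ toℕ b)) % N) % N    ≡⟨ cong (λ k → (toℕ a ℕ.+ k) % N) (toℕ-⊖ 0ₙ b) ⟨
    (toℕ a ℕ.+ toℕ (neg b)) % N                       ≡⟨ toℕ-⊕ a (neg b) ⟨
    toℕ (a ⊕ neg b)                                   ∎)
    where open ≡-Reasoning

  ⊕-inverseʳ : ∀ a → a ⊕ neg a ≡ 0ₙ
  ⊕-inverseʳ a = toℕ-injective (begin
    toℕ (a ⊕ neg a)                  ≡⟨ cong toℕ (⊖≡⊕neg a a) ⟨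
    toℕ (a ⊖ a)                      ≡⟨ toℕ-⊖ a a ⟩
    (toℕ a ℕ.+ (N ℕ.∸ toℕ a)) % N    ≡⟨ cong (_% N) (ℕ.m+[n∸m]≡n (toℕ≤n a)) ⟩
    N % N                            ≡⟨ n%n≡0 N ⟩
    0                                ≡⟨ toℕ-0ₙ ⟨
    toℕ 0ₙ                           ∎)
    where open ≡-Reasoning

  ⊕-abelianGroup : AbelianGroup 0ℓ 0ℓ
  ⊕-abelianGroup = record
    { isAbelianGroup = record
      { isGroup = record
        { isMonoid = record
          { isSemigroup = record
            { isMagma = record { isEquivalence = isEquivalence ; ∙-cong = cong₂ _⊕_ }
            ; assoc = ⊕-assoc
            }
          ; identity = (λ a → trans (⊕-comm 0ₙ a) (⊕-identityʳ a)) , ⊕-identityʳ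
          }
        ; inverse = (λ a → trans (⊕-comm (neg a) a) (⊕-inverseʳ a)) , ⊕-inverseʳ
        ; ⁻¹-cong = cong neg
        }
      ; comm = ⊕-comm
      }
    }

  open AbelianGroupProperties ⊕-abelianGroup

  ⊕-⊖-cancel : ∀ a k → (a ⊕ k) ⊖ k ≡ a
  ⊕-⊖-cancel a k = trans (⊖≡⊕neg (a ⊕ k) k) (//-rightDividesʳ k a)

  ⊖-⊕-cancel : ∀ a k → (a ⊖ k) ⊕ k ≡ a
  ⊖-⊕-cancel a k = trans (cong (_⊕ k) (⊖≡⊕neg a k)) (//-rightDividesˡ k a)

  ⊖-involutive : ∀ s a → s ⊖ (s ⊖ a) ≡ a
  ⊖-involutive s a = begin
    s ⊖ (s ⊖ a)            ≡⟨ trans (⊖≡⊕neg s (s ⊖ a)) (cong (λ b → s ⊕ neg b) (⊖≡⊕neg s a)) ⟩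
    s ⊕ neg (s ⊕ neg a)    ≡⟨ cong (s ⊕_) (⁻¹-anti-homo-// s a) ⟩
    s ⊕ (a ⊕ neg s)        ≡⟨ ⊕-assoc s a (neg s) ⟨
    s ⊕ a ⊕ neg s          ≡⟨ xyx⁻¹≈y s a ⟩
    a                      ∎
    where open ≡-Reasoning

  ⊕-⊖-⊕ : ∀ a b s → a ⊕ (s ⊖ (a ⊕ b)) ≡ s ⊖ b
  ⊕-⊖-⊕ a b s = begin
    a ⊕ (s ⊖ (a ⊕ b))          ≡⟨ cong (a ⊕_) (⊖≡⊕neg s (a ⊕ b)) ⟩
    a ⊕ (s ⊕ neg (a ⊕ b))      ≡⟨ cong (λ c → a ⊕ (s ⊕ c)) (⁻¹-∙-comm a b) ⟨
    a ⊕ (s ⊕ (neg a ⊕ neg b))  ≡⟨ cong (a ⊕_) (⊕-assoc s (neg a) (neg b)) ⟨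
    a ⊕ (s ⊕ neg a ⊕ neg b)    ≡⟨ ⊕-assoc a (s ⊕ neg a) (neg b) ⟨
    a ⊕ (s ⊕ neg a) ⊕ neg b    ≡⟨ cong (_⊕ neg b) (trans (sym (⊕-assoc a s (neg a))) (xyx⁻¹≈y a s)) ⟩
    s ⊕ neg b                  ≡⟨ ⊖≡⊕neg s b ⟨
    s ⊖ b                      ∎
    where open ≡-Reasoning

  ⊕-⊖-shift : ∀ a b c → (a ⊕ b) ⊖ c ≡ a ⊖ (c ⊖ b)
  ⊕-⊖-shift a b c = begin
    (a ⊕ b) ⊖ c          ≡⟨ ⊖≡⊕neg (a ⊕ b) c ⟩
    a ⊕ b ⊕ neg c        ≡⟨ ⊕-assoc a b (neg c) ⟩
    a ⊕ (b ⊕ neg c)      ≡⟨ cong (a ⊕_) (⁻¹-anti-homo-// c b) ⟨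
    a ⊕ neg (c ⊕ neg b)  ≡⟨ trans (⊖≡⊕neg a (c ⊖ b)) (cong (λ d → a ⊕ neg d) (⊖≡⊕neg c b)) ⟨
    a ⊖ (c ⊖ b)          ∎
    where open ≡-Reasoning

  Σ-translate : ∀ (f : Fin N → ℚ) k → Σ N (λ i → f (i ⊖ k)) ≡ Σ N f
  Σ-translate f k = Σ-permute N f (permutation (_⊖ k) (_⊕ k) (λ i → ⊕-⊖-cancel i k) (λ i → ⊖-⊕-cancel i k))

  Σ-translate-⊕ : ∀ (f : Fin N → ℚ) k → Σ N (λ i → f (i ⊕ k)) ≡ Σ N f
  Σ-translate-⊕ f k = Σ-permute N f (permutation (_⊕ k) (_⊖ k) (λ i → ⊖-⊕-cancel i k) (λ i → ⊕-⊖-cancel i k))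

  Σ-reflect : ∀ (f : Fin N → ℚ) k → Σ N (λ i → f (k ⊖ i)) ≡ Σ N f
  Σ-reflect f k = Σ-permute N f (permutation (k ⊖_) (k ⊖_) (⊖-involutive k) (⊖-involutive k))

  Σ-correlation-shift : ∀ (f g : Fin N → ℚ) y y′ →
    Σ N (λ s → f (s ⊖ y) * g (s ⊖ y′)) ≡ Σ N (λ u → f u * g (u ⊖ (y′ ⊖ y)))
  Σ-correlation-shift f g y y′ = begin
    Σ N (λ s → f (s ⊖ y) * g (s ⊖ y′))               ≡⟨ Σ-translate-⊕ (λ s → f (s ⊖ y) * g (s ⊖ y′)) y ⟨
    Σ N (λ u → f (u ⊕ y ⊖ y) * g (u ⊕ y ⊖ y′))
      ≡⟨ Σ-cong N (λ u → cong₂ (λ p q → f p * g q) (⊕-⊖-cancel u y) (⊕-⊖-shift u y y′)) ⟩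
    Σ N (λ u → f u * g (u ⊖ (y′ ⊖ y)))               ∎
    where open ≡-Reasoning

  Σ-gram-correlation-bound : ∀ (G : Fin N → Fin N → ℚ) (P Q : Fin N → Bool) (ρ : Fin N → ℚ) →
    (∀ x y → sq (G x y) ≤ χ (P x) * χ (Q y)) →
    sq (Σ N λ y → Σ N λ y′ → sq (Σ N λ x → G x y * G x y′) * ρ (y′ ⊖ y))
      ≤ (Σ N (χ ∘ P) ^ℚ 4 * sq (Σ N (χ ∘ Q))) * (Σ N (λ k → sq (ρ k)) * ι N)
  Σ-gram-correlation-bound G P Q ρ G²≤PQ = begin
    sq (S².∑ λ { (y , y′) → sq (gram y y′) * ρ (y′ ⊖ y) })
      ≤⟨ S².cauchy-schwarz (λ { (y , y′) → sq (gram y y′) }) (λ { (y , y′) → ρ (y′ ⊖ y) }) ⟩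
    S².∑ (λ { (y , y′) → sq (sq (gram y y′)) }) * S².∑ (λ { (y , y′) → sq (ρ (y′ ⊖ y)) })
      ≤⟨ *-monoʳ-≤ (S².∑-nonNeg λ { (y , y′) → 0≤sq (ρ (y′ ⊖ y)) }) Σgram⁴≤ ⟩
    p ^ℚ 4 * sq q * S².∑ (λ { (y , y′) → sq (ρ (y′ ⊖ y)) })
      ≡⟨ cong (p ^ℚ 4 * sq q *_) (trans (Σ-cong N (λ y → Σ-translate (λ k → sq (ρ k)) y)) (Σ-const N _)) ⟩
    p ^ℚ 4 * sq q * (Σ N (λ k → sq (ρ k)) * ι N) ∎
    where
    open ≤-Reasoning
    module S¹ = SummationProperties (Σ-summation N)
    module S² = SummationProperties (Σ-summation N ⊗ Σ-summation N)
    p = Σ N (χ ∘ P)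
    q = Σ N (χ ∘ Q)
    gram : Fin N → Fin N → ℚ
    gram y y′ = Σ N (λ x → G x y * G x y′)
    column≤ : ∀ y → Σ N (λ x → sq (G x y)) ≤ p * χ (Q y)
    column≤ y = ≤-trans (Σ-mono-≤ N (λ x → G²≤PQ x y)) (≤-reflexive (S¹.*-distribʳ-∑ (χ (Q y)) (χ ∘ P)))
    gram²≤ : ∀ y y′ → sq (gram y y′) ≤ (p * χ (Q y)) * (p * χ (Q y′))
    gram²≤ y y′ = ≤-trans (S¹.cauchy-schwarz (λ x → G x y) (λ x → G x y′))
      (*-mono-≤ (S¹.∑-nonNeg (λ x → 0≤sq (G x y))) (S¹.∑-nonNeg (λ x → 0≤sq (G x y′))) (column≤ y) (column≤ y′))
    fourth : ∀ p u v → sq ((p * u) * (p * v)) ≡ p ^ℚ 4 * ((u * u) * (v * v))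
    fourth = solve 3 (λ p u v → ((p :* u) :* (p :* v)) :* ((p :* u) :* (p :* v)) := p :^ 4 :* ((u :* u) :* (v :* v))) refl
    Σgram⁴≤ : S².∑ (λ { (y , y′) → sq (sq (gram y y′)) }) ≤ p ^ℚ 4 * sq q
    Σgram⁴≤ = begin
      S².∑ (λ { (y , y′) → sq (sq (gram y y′)) })
        ≤⟨ S².∑-mono-≤ (λ { (y , y′) → sq-mono-≤ (0≤sq (gram y y′)) (gram²≤ y y′) }) ⟩
      S².∑ (λ { (y , y′) → sq ((p * χ (Q y)) * (p * χ (Q y′))) })
        ≡⟨ S².∑-cong (λ { (y , y′) → trans (fourth p (χ (Q y)) (χ (Q y′)))
                                             (cong₂ (λ u v → p ^ℚ 4 * (u * v)) (χ-idem (Q y)) (χ-idem (Q y′))) }) ⟩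
      S².∑ (λ { (y , y′) → p ^ℚ 4 * (χ (Q y) * χ (Q y′)) })
        ≡⟨ S².*-distribˡ-∑ (p ^ℚ 4) _ ⟩
      p ^ℚ 4 * Σ N (λ y → Σ N (λ y′ → χ (Q y) * χ (Q y′)))
        ≡⟨ cong (p ^ℚ 4 *_) (S¹.sq-∑ (χ ∘ Q)) ⟨
      p ^ℚ 4 * sq q ∎

module Autocorrelation (N : ℕ) .{{_ : NonZero N}} (E : Fin N → Bool) where
  open Cyclic N
  open SummationProperties (Σ-summation N) using (∑-linear₃)

  density : ℚ
  density = frac (card N E) N

  φ : Fin N → ℚ
  φ s = χ (E s) - density

  -- IsUniformSet N E γ says exactly Σₖ ρ(k)² ≤ γ N³.
  ρ : Fin N → ℚ
  ρ k = Σ N (λ s → φ s * φ (s ⊖ k))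

  0≤density : 0ℚ ≤ density
  0≤density = 0≤frac (card N E) N

  density≤1 : density ≤ 1ℚ
  density≤1 = frac≤1 (card N E) N (begin
    ι (card N E)       ≡⟨ card≡Σχ N E ⟩
    Σ N (χ ∘ E)        ≤⟨ Σ-mono-≤ N (λ s → χ-≤1 (E s)) ⟩
    Σ N (λ _ → 1ℚ)     ≡⟨ trans (Σ-const N 1ℚ) (*-identityˡ (ι N)) ⟩
    ι N                ∎)
    where open ≤-Reasoning

  Σχ≡density*N : Σ N (χ ∘ E) ≡ density * ι N
  Σχ≡density*N = trans (sym (card≡Σχ N E)) (sym (frac*ι (card N E) N))

  density-unique : ∀ {β} → ι (card N E) ≡ β * ι N → density ≡ β
  density-unique ∣E∣≡βN =
    ≤-antisym (*-cancelʳ-≤ (0<ι N) (≤-reflexive densityN≡βN)) (*-cancelʳ-≤ (0<ι N) (≤-reflexive (sym densityN≡βN)))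
    where
    densityN≡βN = trans (frac*ι (card N E) N) ∣E∣≡βN

  Σφ≡0 : Σ N φ ≡ 0ℚ
  Σφ≡0 = begin
    Σ N φ                                    ≡⟨ Σ-distrib-+ N (χ ∘ E) (λ _ → - density) ⟩
    Σ N (χ ∘ E) + Σ N (λ _ → - density)      ≡⟨ cong₂ _+_ (sym (card≡Σχ N E)) (Σ-const N (- density)) ⟩
    ι (card N E) + - density * ι N           ≡⟨ cong (ι (card N E) +_) (neg-distribˡ-* density (ι N)) ⟨
    ι (card N E) - density * ι N             ≡⟨ cong (λ t → ι (card N E) - t) (frac*ι (card N E) N) ⟩
    ι (card N E) - ι (card N E)              ≡⟨ +-inverseʳ (ι (card N E)) ⟩
    0ℚ                                       ∎
    where open ≡-Reasoning

  Σχχ≡density²N+ρ : ∀ k → Σ N (λ s → χ (E s) * χ (E (s ⊖ k))) ≡ density * density * ι N + ρ k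
  Σχχ≡density²N+ρ k = begin
    Σ N (λ s → χ (E s) * χ (E (s ⊖ k)))
      ≡⟨ Σ-cong N (λ s → split (χ (E s)) (χ (E (s ⊖ k))) density) ⟩
    Σ N (λ s → density * density + density * φ s + density * φ (s ⊖ k) + φ s * φ (s ⊖ k))
      ≡⟨ Σ-distrib-+ N _ _ ⟩
    Σ N (λ s → density * density + density * φ s + density * φ (s ⊖ k)) + ρ k
      ≡⟨ cong (_+ ρ k) (∑-linear₃ density density density (λ _ → density) φ (λ s → φ (s ⊖ k))) ⟩
    density * Σ N (λ _ → density) + density * Σ N φ + density * Σ N (λ s → φ (s ⊖ k)) + ρ k
      ≡⟨ cong (λ t → density * Σ N (λ _ → density) + density * Σ N φ + density * t + ρ k) (Σ-translate φ k) ⟩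
    density * Σ N (λ _ → density) + density * Σ N φ + density * Σ N φ + ρ k
      ≡⟨ cong₂ (λ t u → density * t + density * u + density * u + ρ k) (Σ-const N density) Σφ≡0 ⟩
    density * (density * ι N) + density * 0ℚ + density * 0ℚ + ρ k
      ≡⟨ tidy density (ι N) (ρ k) ⟩
    density * density * ι N + ρ k ∎
    where
    open ≡-Reasoning
    split : ∀ e e′ d → e * e′ ≡ d * d + d * (e - d) + d * (e′ - d) + (e - d) * (e′ - d)
    split = solve-∀ ℚ-ring
    tidy : ∀ d n r → d * (d * n) + d * 0ℚ + d * 0ℚ + r ≡ d * d * n + r
    tidy = solve-∀ ℚ-ring

-- Scalar inequalities

correlation-term-bound : ∀ {R U γ p q k n} → 0ℚ ≤ n → 0ℚ ≤ p → 0ℚ ≤ q → 0ℚ ≤ k →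
  sq R ≤ ((p * n) ^ℚ 4 * sq (q * n)) * (U * n) → U ≤ γ * n ^ℚ 3 → p ^ℚ 4 * sq q * γ ≤ sq k →
  R ≤ k * n ^ℚ 5
correlation-term-bound {R} {U} {γ} {p} {q} {k} {n} 0≤n 0≤p 0≤q 0≤k R²≤ U≤ γ≤ =
  sq≤sq⇒≤ (0≤* 0≤k (^ℚ-nonNeg 5 0≤n)) (begin
    sq R                                        ≤⟨ R²≤ ⟩
    ((p * n) ^ℚ 4 * sq (q * n)) * (U * n)       ≤⟨ *-monoˡ-≤ 0≤pq (*-monoʳ-≤ 0≤n U≤) ⟩
    ((p * n) ^ℚ 4 * sq (q * n)) * (γ * n ^ℚ 3 * n) ≡⟨ regroup p q γ n ⟩
    (p ^ℚ 4 * sq q * γ) * n ^ℚ 10               ≤⟨ *-monoʳ-≤ (^ℚ-nonNeg 10 0≤n) γ≤ ⟩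
    sq k * n ^ℚ 10                              ≡⟨ square k n ⟩
    sq (k * n ^ℚ 5)                             ∎)
  where
  open ≤-Reasoning
  0≤pq : 0ℚ ≤ (p * n) ^ℚ 4 * sq (q * n)
  0≤pq = 0≤* (^ℚ-nonNeg 4 (0≤* 0≤p 0≤n)) (0≤sq (q * n))
  regroup : ∀ p q γ n → ((p * n) ^ℚ 4 * sq (q * n)) * (γ * n ^ℚ 3 * n) ≡ (p ^ℚ 4 * sq q * γ) * n ^ℚ 10
  regroup = solve 4 (λ p q γ n → ((p :* n) :^ 4 :* ((q :* n) :* (q :* n))) :* (γ :* n :^ 3 :* n)
                                 := (p :^ 4 :* (q :* q) :* γ) :* n :^ 10) refl
  square : ∀ k n → sq k * n ^ℚ 10 ≡ sq (k * n ^ℚ 5)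
  square = solve 2 (λ k n → (k :* k) :* n :^ 10 := (k :* n :^ 5) :* (k :* n :^ 5)) refl

-- The conclusion is the hypothesis of fourth-moment-lower-bound; it needs 2·10⁻¹⁰⁸ + 4·10⁻⁴ ≤ 4⁻⁴.
Q-bound : ∀ {Q □ R₁ R₂ α d b₁ b₂ n} → 0ℚ ≤ n → 0ℚ ≤ d → 0ℚ ≤ b₁ → 0ℚ ≤ b₂ →
  Q ≤ 2ℚ * (b₂ * b₂) * (b₁ * b₁ * n * □ + R₁) + 2ℚ * R₂ →
  □ ≤ α * sq (b₁ * n) * sq (b₂ * n) → α ≤ tenNeg 108 * d ^ℚ 8 →
  R₁ ≤ tenNeg 4 * d ^ℚ 8 * (b₁ ^ℚ 4 * sq b₂) * n ^ℚ 5 →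
  R₂ ≤ tenNeg 4 * d ^ℚ 8 * (b₁ ^ℚ 4 * b₂ ^ℚ 4) * n ^ℚ 5 →
  n ^ℚ 3 * Q ≤ ¼ ^ℚ 4 * (d ^ℚ 4 * (d * (b₁ * n) * (b₂ * n)) ^ℚ 4)
Q-bound {Q} {□} {R₁} {R₂} {α} {d} {b₁} {b₂} {n} 0≤n 0≤d 0≤b₁ 0≤b₂ Q≤ □≤ α≤ R₁≤ R₂≤ = begin
  n ^ℚ 3 * Q
    ≤⟨ *-monoˡ-≤ (^ℚ-nonNeg 3 0≤n) Q≤ ⟩
  n ^ℚ 3 * (2ℚ * (b₂ * b₂) * (b₁ * b₁ * n * □ + R₁) + 2ℚ * R₂)
    ≤⟨ *-monoˡ-≤ (^ℚ-nonNeg 3 0≤n) (+-mono-≤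
         (*-monoˡ-≤ (0≤* 0≤2 (0≤* 0≤b₂ 0≤b₂))
                    (+-mono-≤ (*-monoˡ-≤ (0≤* (0≤* 0≤b₁ 0≤b₁) 0≤n) □≤′) R₁≤))
         (*-monoˡ-≤ 0≤2 R₂≤)) ⟩
  n ^ℚ 3 * (2ℚ * (b₂ * b₂) * (b₁ * b₁ * n * (tenNeg 108 * d ^ℚ 8 * sq (b₁ * n) * sq (b₂ * n))
             + tenNeg 4 * d ^ℚ 8 * (b₁ ^ℚ 4 * sq b₂) * n ^ℚ 5)
           + 2ℚ * (tenNeg 4 * d ^ℚ 8 * (b₁ ^ℚ 4 * b₂ ^ℚ 4) * n ^ℚ 5))
    ≡⟨ collect (tenNeg 108) (tenNeg 4) d b₁ b₂ n ⟩
  (2ℚ * tenNeg 108 + 2ℚ * 2ℚ * tenNeg 4) * (d ^ℚ 8 * b₁ ^ℚ 4 * b₂ ^ℚ 4 * n ^ℚ 8)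
    ≤⟨ *-monoʳ-≤ 0≤monomial constants ⟩
  ¼ ^ℚ 4 * (d ^ℚ 8 * b₁ ^ℚ 4 * b₂ ^ℚ 4 * n ^ℚ 8)
    ≡⟨ cong (¼ ^ℚ 4 *_) (expand d b₁ b₂ n) ⟩
  ¼ ^ℚ 4 * (d ^ℚ 4 * (d * (b₁ * n) * (b₂ * n)) ^ℚ 4) ∎
  where
  open ≤-Reasoning
  0≤2 : 0ℚ ≤ 2ℚ
  0≤2 = ≤ᵇ⇒≤ _
  constants : 2ℚ * tenNeg 108 + 2ℚ * 2ℚ * tenNeg 4 ≤ ¼ ^ℚ 4
  constants = ≤ᵇ⇒≤ _
  0≤monomial : 0ℚ ≤ d ^ℚ 8 * b₁ ^ℚ 4 * b₂ ^ℚ 4 * n ^ℚ 8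
  0≤monomial = 0≤* (0≤* (0≤* (^ℚ-nonNeg 8 0≤d) (^ℚ-nonNeg 4 0≤b₁)) (^ℚ-nonNeg 4 0≤b₂)) (^ℚ-nonNeg 8 0≤n)
  □≤′ : □ ≤ tenNeg 108 * d ^ℚ 8 * sq (b₁ * n) * sq (b₂ * n)
  □≤′ = ≤-trans □≤ (*-monoʳ-≤ (0≤sq (b₂ * n)) (*-monoʳ-≤ (0≤sq (b₁ * n)) α≤))
  collect : ∀ t c d b₁ b₂ n →
    n ^ℚ 3 * (2ℚ * (b₂ * b₂) * (b₁ * b₁ * n * (t * d ^ℚ 8 * sq (b₁ * n) * sq (b₂ * n))
                + c * d ^ℚ 8 * (b₁ ^ℚ 4 * sq b₂) * n ^ℚ 5)
              + 2ℚ * (c * d ^ℚ 8 * (b₁ ^ℚ 4 * b₂ ^ℚ 4) * n ^ℚ 5))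
    ≡ (2ℚ * t + 2ℚ * 2ℚ * c) * (d ^ℚ 8 * b₁ ^ℚ 4 * b₂ ^ℚ 4 * n ^ℚ 8)
  collect = solve 6 (λ t c d b₁ b₂ n →
    n :^ 3 :* (con 2ℚ :* (b₂ :* b₂) :* (b₁ :* b₁ :* n :* (t :* d :^ 8 :* ((b₁ :* n) :* (b₁ :* n)) :* ((b₂ :* n) :* (b₂ :* n)))
                :+ c :* d :^ 8 :* (b₁ :^ 4 :* (b₂ :* b₂)) :* n :^ 5)
              :+ con 2ℚ :* (c :* d :^ 8 :* (b₁ :^ 4 :* b₂ :^ 4) :* n :^ 5))
    := (con 2ℚ :* t :+ con 2ℚ :* con 2ℚ :* c) :* (d :^ 8 :* b₁ :^ 4 :* b₂ :^ 4 :* n :^ 8)) refl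
  expand : ∀ d b₁ b₂ n → d ^ℚ 8 * b₁ ^ℚ 4 * b₂ ^ℚ 4 * n ^ℚ 8 ≡ d ^ℚ 4 * (d * (b₁ * n) * (b₂ * n)) ^ℚ 4
  expand = solve 4 (λ d b₁ b₂ n → d :^ 8 :* b₁ :^ 4 :* b₂ :^ 4 :* n :^ 8 := d :^ 4 :* (d :* (b₁ :* n) :* (b₂ :* n)) :^ 4) refl

fourth-moment-lower-bound : ∀ {L Y P Q m n d} → 0ℚ < n → 0ℚ ≤ d → 0ℚ ≤ P →
  sq m ≤ n * P → sq L ≤ m * Y → sq Y ≤ P * Q →
  n ^ℚ 3 * Q ≤ ¼ ^ℚ 4 * (d ^ℚ 4 * m ^ℚ 4) → - (d * P * ¼) ≤ L
fourth-moment-lower-bound {L} {Y} {P} {Q} {m} {n} {d} 0<n 0≤d 0≤P m²≤nP L²≤mY Y²≤PQ n³Q≤ =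
  sq≤sq⇒-≤ 0≤u (sq≤sq⇒≤ (0≤sq u) (*-cancelʳ-≤ (^ℚ-pos 3 0<n) (begin
    sq (sq L) * n ^ℚ 3                    ≤⟨ *-monoʳ-≤ n³≥0 (sq-mono-≤ (0≤sq L) L²≤mY) ⟩
    sq (m * Y) * n ^ℚ 3                   ≡⟨ regroup₁ m Y n ⟩
    sq m * sq Y * n ^ℚ 3                  ≤⟨ *-monoʳ-≤ n³≥0 (*-monoˡ-≤ (0≤sq m) Y²≤PQ) ⟩
    sq m * (P * Q) * n ^ℚ 3               ≡⟨ regroup₂ m P Q n ⟩
    sq m * P * (n ^ℚ 3 * Q)               ≤⟨ *-monoˡ-≤ (0≤* (0≤sq m) 0≤P) n³Q≤ ⟩
    sq m * P * (¼ ^ℚ 4 * (d ^ℚ 4 * m ^ℚ 4)) ≡⟨ regroup₃ m P d ⟩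
    ¼ ^ℚ 4 * d ^ℚ 4 * P * sq m ^ℚ 3       ≤⟨ *-monoˡ-≤ c≥0 (^ℚ-mono-≤ 3 (0≤sq m) m²≤nP) ⟩
    ¼ ^ℚ 4 * d ^ℚ 4 * P * (n * P) ^ℚ 3    ≡⟨ regroup₄ d P n ⟩
    sq (sq u) * n ^ℚ 3                    ∎)))
  where
  open ≤-Reasoning
  u = d * P * ¼
  0≤u : 0ℚ ≤ u
  0≤u = 0≤* {q = ¼} (0≤* 0≤d 0≤P) (≤ᵇ⇒≤ _)
  n³≥0 : 0ℚ ≤ n ^ℚ 3
  n³≥0 = ^ℚ-nonNeg 3 (<⇒≤ 0<n)
  c≥0 : 0ℚ ≤ ¼ ^ℚ 4 * d ^ℚ 4 * P
  c≥0 = 0≤* (0≤* {¼ ^ℚ 4} (≤ᵇ⇒≤ _) (^ℚ-nonNeg 4 0≤d)) 0≤P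
  regroup₁ : ∀ m Y n → sq (m * Y) * n ^ℚ 3 ≡ sq m * sq Y * n ^ℚ 3
  regroup₁ = solve 3 (λ m Y n → (m :* Y) :* (m :* Y) :* n :^ 3 := (m :* m) :* (Y :* Y) :* n :^ 3) refl
  regroup₂ : ∀ m P Q n → sq m * (P * Q) * n ^ℚ 3 ≡ sq m * P * (n ^ℚ 3 * Q)
  regroup₂ = solve 4 (λ m P Q n → (m :* m) :* (P :* Q) :* n :^ 3 := (m :* m) :* P :* (n :^ 3 :* Q)) refl
  regroup₃ : ∀ m P d → sq m * P * (¼ ^ℚ 4 * (d ^ℚ 4 * m ^ℚ 4)) ≡ ¼ ^ℚ 4 * d ^ℚ 4 * P * sq m ^ℚ 3
  regroup₃ = solve 3 (λ m P d → (m :* m) :* P :* (con ¼ :^ 4 :* (d :^ 4 :* m :^ 4))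
                                := con ¼ :^ 4 :* d :^ 4 :* P :* (m :* m) :^ 3) refl
  regroup₄ : ∀ d P n → ¼ ^ℚ 4 * d ^ℚ 4 * P * (n * P) ^ℚ 3 ≡ sq (sq (d * P * ¼)) * n ^ℚ 3
  regroup₄ = solve 3 (λ d P n → con ¼ :^ 4 :* d :^ 4 :* P :* (n :* P) :^ 3
                                := ((d :* P :* con ¼) :* (d :* P :* con ¼)) :* ((d :* P :* con ¼) :* (d :* P :* con ¼)) :* n :^ 3) refl

uniformity-constant-bound : ∀ {b₁ b₂ d} i j → i ℕ.≤ 24 → j ℕ.≤ 24 →
  0ℚ ≤ b₁ → b₁ ≤ 1ℚ → 0ℚ ≤ b₂ → b₂ ≤ 1ℚ → 0ℚ ≤ d → d ≤ 1ℚ →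
  tenNeg 330 * b₁ ^ℚ 24 * b₂ ^ℚ 24 * d ^ℚ 132 ≤ sq (tenNeg 4) * b₁ ^ℚ i * b₂ ^ℚ j * d ^ℚ 16
uniformity-constant-bound i j i≤24 j≤24 0≤b₁ b₁≤1 0≤b₂ b₂≤1 0≤d d≤1 =
  *-mono-≤ (0≤* (0≤* 0≤t (^ℚ-nonNeg 24 0≤b₁)) (^ℚ-nonNeg 24 0≤b₂)) (^ℚ-nonNeg 132 0≤d)
    (*-mono-≤ (0≤* 0≤t (^ℚ-nonNeg 24 0≤b₁)) (^ℚ-nonNeg 24 0≤b₂)
      (*-mono-≤ 0≤t (^ℚ-nonNeg 24 0≤b₁) t≤c² (^ℚ-antimono i≤24 0≤b₁ b₁≤1))
      (^ℚ-antimono j≤24 0≤b₂ b₂≤1))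
    (^ℚ-antimono (ℕ.≤ᵇ⇒≤ 16 132 _) 0≤d d≤1)
  where
  0≤t : 0ℚ ≤ tenNeg 330
  0≤t = ≤ᵇ⇒≤ _
  t≤c² : tenNeg 330 ≤ sq (tenNeg 4)
  t≤c² = ≤ᵇ⇒≤ _

large-N⇒0<b₁n*b₂n : ∀ {n d b₁ b₂} → 0ℚ < n → 0ℚ ≤ d →
  ι (10 ^ 10) ≤ n * (d ^ℚ 4 * b₁ * b₂) → 0ℚ < (b₁ * n) * (b₂ * n)
large-N⇒0<b₁n*b₂n {n} {d} {b₁} {b₂} 0<n 0≤d 10¹⁰≤w =
  *-cancelʳ-<-nonNeg (d ^ℚ 4) {{nonNegative (^ℚ-nonNeg 4 0≤d)}} (begin-strict
  0ℚ * d ^ℚ 4                          ≡⟨ *-zeroˡ (d ^ℚ 4) ⟩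
  0ℚ                                   <⟨ 0<* (<-≤-trans (from-yes (0ℚ <? ι (10 ^ 10))) 10¹⁰≤w) 0<n ⟩
  n * (d ^ℚ 4 * b₁ * b₂) * n           ≡⟨ regroup n d b₁ b₂ ⟩
  (b₁ * n) * (b₂ * n) * d ^ℚ 4         ∎)
  where
  open ≤-Reasoning
  regroup : ∀ n d b₁ b₂ → n * (d ^ℚ 4 * b₁ * b₂) * n ≡ (b₁ * n) * (b₂ * n) * d ^ℚ 4
  regroup = solve 4 (λ n d b₁ b₂ → n :* (d :^ 4 :* b₁ :* b₂) :* n := (b₁ :* n) :* (b₂ :* n) :* d :^ 4) refl

large-N-contradiction : ∀ {m P n d b₁ b₂} → 0ℚ < n → 0ℚ ≤ d → d ≤ 1ℚ →
  m ≡ d * (b₁ * n) * (b₂ * n) → sq m ≤ n * P → d * P * ½ ≤ m →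
  ι (10 ^ 10) ≤ n * (d ^ℚ 4 * b₁ * b₂) → ⊥
large-N-contradiction {m} {P} {n} {d} {b₁} {b₂} 0<n 0≤d d≤1 m≡ m²≤nP dP/2≤m 10¹⁰≤w =
  <-irrefl refl (<-≤-trans 2<10¹⁰ (≤-trans 10¹⁰≤w w≤2))
  where
  open ≤-Reasoning
  w = n * (d ^ℚ 4 * b₁ * b₂)
  2<10¹⁰ : 2ℚ < ι (10 ^ 10)
  2<10¹⁰ = from-yes (2ℚ <? ι (10 ^ 10))
  0<w : 0ℚ < w
  0<w = <-≤-trans (from-yes (0ℚ <? ι (10 ^ 10))) 10¹⁰≤w
  0<m : 0ℚ < m
  0<m = *-cancelʳ-<-nonNeg (d ^ℚ 3) {{nonNegative (^ℚ-nonNeg 3 0≤d)}} (begin-strict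
    0ℚ * d ^ℚ 3    ≡⟨ *-zeroˡ (d ^ℚ 3) ⟩
    0ℚ             <⟨ 0<* 0<w 0<n ⟩
    w * n          ≡⟨ trans (identity d b₁ b₂ n) (cong (_* d ^ℚ 3) (sym m≡)) ⟩
    m * d ^ℚ 3     ∎)
    where
    identity : ∀ d b₁ b₂ n → n * (d ^ℚ 4 * b₁ * b₂) * n ≡ d * (b₁ * n) * (b₂ * n) * d ^ℚ 3
    identity = solve 4 (λ d b₁ b₂ n → n :* (d :^ 4 :* b₁ :* b₂) :* n := d :* (b₁ :* n) :* (b₂ :* n) :* d :^ 3) refl
  dm≤2n : d * m ≤ 2ℚ * n
  dm≤2n = *-cancelʳ-≤ 0<m (begin
    d * m * m              ≡⟨ *-assoc d m m ⟩
    d * sq m               ≤⟨ *-monoˡ-≤ 0≤d m²≤nP ⟩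
    d * (n * P)            ≡⟨ identity d n P ⟩
    2ℚ * n * (d * P * ½)   ≤⟨ *-monoˡ-≤ (0≤* {2ℚ} (≤ᵇ⇒≤ _) (<⇒≤ 0<n)) dP/2≤m ⟩
    2ℚ * n * m             ∎)
    where
    identity : ∀ d n P → d * (n * P) ≡ 2ℚ * n * (d * P * ½)
    identity = solve-∀ ℚ-ring
  w≤2 : w ≤ 2ℚ
  w≤2 = *-cancelʳ-≤ 0<n (begin
    w * n                  ≡⟨ trans (identity d b₁ b₂ n) (cong (λ t → d * d * (d * t)) (sym m≡)) ⟩
    d * d * (d * m)        ≤⟨ *-mono-≤ (0≤* 0≤d 0≤d) (0≤* 0≤d (<⇒≤ 0<m)) d²≤1 dm≤2n ⟩
    1ℚ * (2ℚ * n)          ≡⟨ *-identityˡ (2ℚ * n) ⟩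
    2ℚ * n                 ∎)
    where
    identity : ∀ d b₁ b₂ n → n * (d ^ℚ 4 * b₁ * b₂) * n ≡ d * d * (d * (d * (b₁ * n) * (b₂ * n)))
    identity = solve 4 (λ d b₁ b₂ n → n :* (d :^ 4 :* b₁ :* b₂) :* n := d :* d :* (d :* (d :* (b₁ :* n) :* (b₂ :* n)))) refl
    d²≤1 : d * d ≤ 1ℚ
    d²≤1 = ≤-trans (*-mono-≤ 0≤d 0≤d d≤1 d≤1) (≤-reflexive (*-identityˡ 1ℚ))

-- Counting corners

module Corners (N : ℕ) .{{_ : NonZero N}} (E₁ E₂ : Fin N → Bool) (A : Fin N → Fin N → Bool)
               (A⊆E₁×E₂ : ∀ x y → A x y ≡ true → (E₁ x ≡ true) × (E₂ y ≡ true)) where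

  open Cyclic N
  open Autocorrelation N E₁ using ()
    renaming (density to β₁; ρ to ρ₁; 0≤density to 0≤β₁; density≤1 to β₁≤1; Σχ≡density*N to Σe₁≡β₁N;
              Σχχ≡density²N+ρ to Σe₁e₁≡β₁²N+ρ₁)
  open Autocorrelation N E₂ using ()
    renaming (density to β₂; φ to φ₂; ρ to ρ₂; 0≤density to 0≤β₂; density≤1 to β₂≤1;
              Σχ≡density*N to Σe₂≡β₂N)

  module S¹ = SummationProperties (Σ-summation N)
  module S² = SummationProperties (Σ-summation N ⊗ Σ-summation N)
  module S³ = SummationProperties (Σ-summation N ⊗ Σ-summation N ⊗ Σ-summation N)

  Σ-comm : ∀ (f : Fin N → Fin N → ℚ) → Σ N (λ i → Σ N (f i)) ≡ Σ N (λ j → Σ N (λ i → f i j))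
  Σ-comm = S¹.Σ-comm-∑ N

  a : Fin N → Fin N → ℚ
  a x y = χ (A x y)

  e₁ e₂ : Fin N → ℚ
  e₁ x = χ (E₁ x)
  e₂ y = χ (E₂ y)

  ν : Fin N → Fin N → ℚ
  ν x y = e₁ x * e₂ y

  e₁*a≡a : ∀ x y → e₁ x * a x y ≡ a x y
  e₁*a≡a x y with A x y in Axy
  ... | false = *-zeroʳ (e₁ x)
  ... | true rewrite proj₁ (A⊆E₁×E₂ x y Axy) = refl

  e₂*a≡a : ∀ x y → e₂ y * a x y ≡ a x y
  e₂*a≡a x y with A x y in Axy
  ... | false = *-zeroʳ (e₂ y)
  ... | true rewrite proj₂ (A⊆E₁×E₂ x y Axy) = refl

  a≤ν : ∀ x y → a x y ≤ ν x y
  a≤ν x y with A x y in Axy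
  ... | false = 0≤* (χ-nonNeg (E₁ x)) (χ-nonNeg (E₂ y))
  ... | true rewrite proj₁ (A⊆E₁×E₂ x y Axy) | proj₂ (A⊆E₁×E₂ x y Axy) = ≤-refl

  a≤e₁ : ∀ x y → a x y ≤ e₁ x
  a≤e₁ x y = begin
    a x y          ≡⟨ e₁*a≡a x y ⟨
    e₁ x * a x y   ≤⟨ *-monoˡ-≤ (χ-nonNeg (E₁ x)) (χ-≤1 (A x y)) ⟩
    e₁ x * 1ℚ      ≡⟨ *-identityʳ (e₁ x) ⟩
    e₁ x           ∎
    where open ≤-Reasoning

  a≤e₂ : ∀ x y → a x y ≤ e₂ y
  a≤e₂ x y = begin
    a x y          ≡⟨ e₂*a≡a x y ⟨
    e₂ y * a x y   ≤⟨ *-monoˡ-≤ (χ-nonNeg (E₂ y)) (χ-≤1 (A x y)) ⟩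
    e₂ y * 1ℚ      ≡⟨ *-identityʳ (e₂ y) ⟩
    e₂ y           ∎
    where open ≤-Reasoning

  ∣A∣ : ℚ
  ∣A∣ = Σ N (λ x → Σ N (a x))

  0≤∣A∣ : 0ℚ ≤ ∣A∣
  0≤∣A∣ = S².∑-nonNeg (λ { (x , y) → χ-nonNeg (A x y) })

  antidiagonal : Fin N → ℚ
  antidiagonal s = Σ N (λ y → a (s ⊖ y) y)

  energy : ℚ
  energy = Σ N (λ s → sq (antidiagonal s))

  0≤energy : 0ℚ ≤ energy
  0≤energy = S¹.∑-nonNeg (λ s → 0≤sq (antidiagonal s))

  -- Λ F weighs each corner (x, y), (x+d, y), (x, y+d) of A by F x y (see Λ≡cornerSum); it is written
  -- with s = x + y + d so that the two factors of a depend only on (y, s) and on (x, s).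
  Λ : (Fin N → Fin N → ℚ) → ℚ
  Λ F = Σ N λ x → Σ N λ y → Σ N λ s → F x y * (a (s ⊖ y) y * a x (s ⊖ x))

  Λ-cong : ∀ {F G} → (∀ x y → F x y ≡ G x y) → Λ F ≡ Λ G
  Λ-cong F≗G = S³.∑-cong (λ { (x , y , s) → cong (_* (a (s ⊖ y) y * a x (s ⊖ x))) (F≗G x y) })

  Λ-+ : ∀ F G → Λ (λ x y → F x y + G x y) ≡ Λ F + Λ G
  Λ-+ F G = trans (S³.∑-cong (λ { (x , y , s) → *-distribʳ-+ _ (F x y) (G x y) })) (S³.∑-distrib-+ _ _)

  Λ-* : ∀ c F → Λ (λ x y → c * F x y) ≡ c * Λ F
  Λ-* c F = trans (S³.∑-cong (λ { (x , y , s) → *-assoc c (F x y) _ })) (S³.*-distribˡ-∑ c _)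

  Λ≡cornerSum : ∀ F → Λ F ≡ Σ N λ x → Σ N λ y → Σ N λ d → F x y * (a (x ⊕ d) y * a x (y ⊕ d))
  Λ≡cornerSum F = Σ-cong N λ x → Σ-cong N λ y → s≔x⊕y⊕d x y
    where
    s≔x⊕y⊕d : ∀ x y → Σ N (λ s → F x y * (a (s ⊖ y) y * a x (s ⊖ x))) ≡
                       Σ N (λ d → F x y * (a (x ⊕ d) y * a x (y ⊕ d)))
    s≔x⊕y⊕d x y = begin
      Σ N (λ s → F x y * (a (s ⊖ y) y * a x (s ⊖ x)))
        ≡⟨ Σ-cong N (λ s → cong₂ (λ u v → F x y * (a u y * a x v)) (sym (⊕-⊖-⊕ x y s)) (sym (y⊕[s⊖[x⊕y]] s))) ⟩
      Σ N (λ s → F x y * (a (x ⊕ (s ⊖ (x ⊕ y))) y * a x (y ⊕ (s ⊖ (x ⊕ y)))))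
        ≡⟨ Σ-translate (λ d → F x y * (a (x ⊕ d) y * a x (y ⊕ d))) (x ⊕ y) ⟩
      Σ N (λ d → F x y * (a (x ⊕ d) y * a x (y ⊕ d))) ∎
      where
      open ≡-Reasoning
      y⊕[s⊖[x⊕y]] : ∀ s → y ⊕ (s ⊖ (x ⊕ y)) ≡ s ⊖ x
      y⊕[s⊖[x⊕y]] s = trans (cong (λ t → y ⊕ (s ⊖ t)) (⊕-comm x y)) (⊕-⊖-⊕ y x s)

  only-trivial-corners : ¬ HasCorner N A → ∀ x y → Σ N (λ d → a x y * (a (x ⊕ d) y * a x (y ⊕ d))) ≡ a x y
  only-trivial-corners noCorner x y = trans (Σ-single N _ 0ₙ nontrivial≡0) trivial
    where
    trivial : a x y * (a (x ⊕ 0ₙ) y * a x (y ⊕ 0ₙ)) ≡ a x y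
    trivial rewrite ⊕-identityʳ x | ⊕-identityʳ y = trans (cong (a x y *_) (χ-idem (A x y))) (χ-idem (A x y))
    nontrivial≡0 : ∀ d → d ≢ 0ₙ → a x y * (a (x ⊕ d) y * a x (y ⊕ d)) ≡ 0ℚ
    nontrivial≡0 d d≢0 with A x y in p | A (x ⊕ d) y in q | A x (y ⊕ d) in r
    ... | false | u     | v     = *-zeroˡ (χ u * χ v)
    ... | true  | false | v     = trans (*-identityˡ (0ℚ * χ v)) (*-zeroˡ (χ v))
    ... | true  | true  | false = refl
    ... | true  | true  | true  =
      ⊥-elim (noCorner (x , y , d , (λ d≡0 → d≢0 (toℕ-injective (trans d≡0 (sym toℕ-0ₙ)))) , p , q , r))

  Λa≡∣A∣ : ¬ HasCorner N A → Λ a ≡ ∣A∣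
  Λa≡∣A∣ noCorner = trans (Λ≡cornerSum a) (Σ-cong N λ x → Σ-cong N λ y → only-trivial-corners noCorner x y)

  Σ-column-antidiagonal : ∀ s → Σ N (λ x → a x (s ⊖ x)) ≡ antidiagonal s
  Σ-column-antidiagonal s = begin
    Σ N (λ x → a x (s ⊖ x))                 ≡⟨ Σ-cong N (λ y → cong (λ x → a x (s ⊖ y)) (⊖-involutive s y)) ⟨
    Σ N (λ y → a (s ⊖ (s ⊖ y)) (s ⊖ y))     ≡⟨ Σ-reflect (λ y → a (s ⊖ y) y) s ⟩
    antidiagonal s                          ∎
    where open ≡-Reasoning

  Λν≡energy : Λ ν ≡ energy
  Λν≡energy = begin
    Λ ν
      ≡⟨ Σ-cong N (λ x → Σ-cong N (λ y → Σ-cong N (λ s → absorb x y s))) ⟩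
    Σ N (λ x → Σ N (λ y → Σ N (λ s → a x (s ⊖ x) * a (s ⊖ y) y)))
      ≡⟨ Σ-cong N (λ x → Σ-comm _) ⟩
    Σ N (λ x → Σ N (λ s → Σ N (λ y → a x (s ⊖ x) * a (s ⊖ y) y)))
      ≡⟨ Σ-comm _ ⟩
    Σ N (λ s → Σ N (λ x → Σ N (λ y → a x (s ⊖ x) * a (s ⊖ y) y)))
      ≡⟨ Σ-cong N (λ s → Σ-cong N (λ x → *-distribˡ-Σ N (a x (s ⊖ x)) _)) ⟩
    Σ N (λ s → Σ N (λ x → a x (s ⊖ x) * antidiagonal s))
      ≡⟨ Σ-cong N (λ s → trans (S¹.*-distribʳ-∑ (antidiagonal s) _) (cong (_* antidiagonal s) (Σ-column-antidiagonal s))) ⟩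
    energy ∎
    where
    open ≡-Reasoning
    absorb : ∀ x y s → ν x y * (a (s ⊖ y) y * a x (s ⊖ x)) ≡ a x (s ⊖ x) * a (s ⊖ y) y
    absorb x y s = begin
      ν x y * (a (s ⊖ y) y * a x (s ⊖ x))                    ≡⟨ regroup (e₁ x) (e₂ y) (a (s ⊖ y) y) (a x (s ⊖ x)) ⟩
      (e₁ x * a x (s ⊖ x)) * (e₂ y * a (s ⊖ y) y)            ≡⟨ cong₂ _*_ (e₁*a≡a x (s ⊖ x)) (e₂*a≡a (s ⊖ y) y) ⟩
      a x (s ⊖ x) * a (s ⊖ y) y                              ∎
      where
      regroup : ∀ p q u v → p * q * (u * v) ≡ (p * v) * (q * u)
      regroup = solve-∀ ℚ-ring

  Σantidiagonal≡∣A∣ : Σ N antidiagonal ≡ ∣A∣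
  Σantidiagonal≡∣A∣ = begin
    Σ N (λ s → Σ N (λ y → a (s ⊖ y) y))   ≡⟨ Σ-comm _ ⟩
    Σ N (λ y → Σ N (λ s → a (s ⊖ y) y))   ≡⟨ Σ-cong N (λ y → Σ-translate (λ x → a x y) y) ⟩
    Σ N (λ y → Σ N (λ x → a x y))         ≡⟨ Σ-comm _ ⟨
    ∣A∣                                   ∎
    where open ≡-Reasoning

  ∣A∣²≤N*energy : sq ∣A∣ ≤ ι N * energy
  ∣A∣²≤N*energy = subst₂ _≤_
    (cong sq (trans (Σ-cong N (λ s → *-identityˡ (antidiagonal s))) Σantidiagonal≡∣A∣))
    (cong (_* energy) (trans (Σ-const N (1ℚ * 1ℚ)) (*-identityˡ (ι N))))
    (S¹.cauchy-schwarz (λ _ → 1ℚ) antidiagonal)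

  module LowerBound (F : Fin N → Fin N → ℚ) where

    Z : Fin N → Fin N → ℚ
    Z x s = Σ N (λ y → F x y * a (s ⊖ y) y)

    Y : ℚ
    Y = Σ N (λ x → Σ N (λ s → e₂ (s ⊖ x) * sq (Z x s)))

    Λ≡ΣaZ : Λ F ≡ Σ N (λ x → Σ N (λ s → a x (s ⊖ x) * Z x s))
    Λ≡ΣaZ = Σ-cong N λ x → trans (Σ-comm _) (Σ-cong N λ s →
      trans (Σ-cong N (λ y → regroup (F x y) (a (s ⊖ y) y) (a x (s ⊖ x)))) (*-distribˡ-Σ N (a x (s ⊖ x)) _))
      where
      regroup : ∀ f u v → f * (u * v) ≡ v * (f * u)
      regroup = solve-∀ ℚ-ring

    Λ²≤∣A∣*Y : sq (Λ F) ≤ ∣A∣ * Y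
    Λ²≤∣A∣*Y = begin
      sq (Λ F)
        ≡⟨ cong sq Λ≡ΣaZ ⟩
      sq (S².∑ λ { (x , s) → a x (s ⊖ x) * Z x s })
        ≤⟨ S².weighted-cauchy-schwarz′ (λ { (x , s) → a x (s ⊖ x) }) (λ { (x , s) → Z x s })
                                       (λ { (x , s) → χ-nonNeg (A x (s ⊖ x)) }) ⟩
      S².∑ (λ { (x , s) → a x (s ⊖ x) }) * S².∑ (λ { (x , s) → a x (s ⊖ x) * sq (Z x s) })
        ≡⟨ cong (_* S².∑ (λ { (x , s) → a x (s ⊖ x) * sq (Z x s) })) (Σ-cong N (λ x → Σ-translate (a x) x)) ⟩
      ∣A∣ * S².∑ (λ { (x , s) → a x (s ⊖ x) * sq (Z x s) })
        ≤⟨ *-monoˡ-≤ 0≤∣A∣ (S².∑-mono-≤ (λ { (x , s) → *-monoʳ-≤ (0≤sq (Z x s)) (a≤e₂ x (s ⊖ x)) })) ⟩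
      ∣A∣ * Y ∎
      where open ≤-Reasoning

    M : Fin N → Fin N → Fin N → ℚ
    M y y′ s = Σ N (λ x → e₂ (s ⊖ x) * (F x y * F x y′))

    Q : ℚ
    Q = Σ N λ y → Σ N λ y′ → Σ N λ s → (e₁ (s ⊖ y) * e₁ (s ⊖ y′)) * sq (M y y′ s)

    w : Fin N → Fin N → Fin N → ℚ
    w y y′ s = a (s ⊖ y) y * a (s ⊖ y′) y′

    0≤w : ∀ y y′ s → 0ℚ ≤ w y y′ s
    0≤w y y′ s = 0≤* (χ-nonNeg (A (s ⊖ y) y)) (χ-nonNeg (A (s ⊖ y′) y′))

    Y≡ΣwM : Y ≡ S³.∑ (λ { (y , y′ , s) → w y y′ s * M y y′ s })
    Y≡ΣwM = begin
      Y
        ≡⟨ Σ-cong N (λ x → Σ-cong N (λ s → expand x s)) ⟩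
      Σ N (λ x → Σ N (λ s → S².∑ (λ { (y , y′) → H x s y y′ })))
        ≡⟨ Σ-cong N (λ x → S².Σ-comm-∑ N (λ s → λ { (y , y′) → H x s y y′ })) ⟩
      Σ N (λ x → S³.∑ (λ { (y , y′ , s) → H x s y y′ }))
        ≡⟨ S³.Σ-comm-∑ N (λ x → λ { (y , y′ , s) → H x s y y′ }) ⟩
      S³.∑ (λ { (y , y′ , s) → Σ N (λ x → H x s y y′) })
        ≡⟨ S³.∑-cong (λ { (y , y′ , s) →
             trans (Σ-cong N (λ x → regroup (e₂ (s ⊖ x)) (F x y) (a (s ⊖ y) y) (F x y′) (a (s ⊖ y′) y′)))
                   (*-distribˡ-Σ N (w y y′ s) (λ x → e₂ (s ⊖ x) * (F x y * F x y′))) }) ⟩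
      S³.∑ (λ { (y , y′ , s) → w y y′ s * M y y′ s }) ∎
      where
      open ≡-Reasoning
      g : Fin N → Fin N → Fin N → ℚ
      g x s y = F x y * a (s ⊖ y) y
      H : Fin N → Fin N → Fin N → Fin N → ℚ
      H x s y y′ = e₂ (s ⊖ x) * (g x s y * g x s y′)
      expand : ∀ x s → e₂ (s ⊖ x) * sq (Z x s) ≡ S².∑ (λ { (y , y′) → H x s y y′ })
      expand x s = begin
        e₂ (s ⊖ x) * sq (Z x s)                                      ≡⟨ cong (e₂ (s ⊖ x) *_) (S¹.sq-∑ (g x s)) ⟩
        e₂ (s ⊖ x) * Σ N (λ y → Σ N (λ y′ → g x s y * g x s y′))     ≡⟨ *-distribˡ-Σ N (e₂ (s ⊖ x)) _ ⟨
        Σ N (λ y → e₂ (s ⊖ x) * Σ N (λ y′ → g x s y * g x s y′))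
          ≡⟨ Σ-cong N (λ y → *-distribˡ-Σ N (e₂ (s ⊖ x)) (λ y′ → g x s y * g x s y′)) ⟨
        S².∑ (λ { (y , y′) → H x s y y′ })                           ∎
      regroup : ∀ e f u g v → e * ((f * u) * (g * v)) ≡ (u * v) * (e * (f * g))
      regroup = solve-∀ ℚ-ring

    Σw≡energy : S³.∑ (λ { (y , y′ , s) → w y y′ s }) ≡ energy
    Σw≡energy = begin
      Σ N (λ y → Σ N (λ y′ → Σ N (λ s → w y y′ s)))   ≡⟨ Σ-cong N (λ y → Σ-comm _) ⟩
      Σ N (λ y → Σ N (λ s → Σ N (λ y′ → w y y′ s)))   ≡⟨ Σ-comm _ ⟩
      Σ N (λ s → Σ N (λ y → Σ N (λ y′ → w y y′ s)))   ≡⟨ Σ-cong N (λ s → S¹.sq-∑ (λ y → a (s ⊖ y) y)) ⟨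
      energy                                          ∎
      where open ≡-Reasoning

    Y²≤energy*Q : sq Y ≤ energy * Q
    Y²≤energy*Q = begin
      sq Y
        ≡⟨ cong sq Y≡ΣwM ⟩
      sq (S³.∑ (λ { (y , y′ , s) → w y y′ s * M y y′ s }))
        ≤⟨ S³.weighted-cauchy-schwarz′ _ (λ { (y , y′ , s) → M y y′ s }) (λ { (y , y′ , s) → 0≤w y y′ s }) ⟩
      S³.∑ (λ { (y , y′ , s) → w y y′ s }) * S³.∑ (λ { (y , y′ , s) → w y y′ s * sq (M y y′ s) })
        ≡⟨ cong (_* S³.∑ (λ { (y , y′ , s) → w y y′ s * sq (M y y′ s) })) Σw≡energy ⟩
      energy * S³.∑ (λ { (y , y′ , s) → w y y′ s * sq (M y y′ s) })
        ≤⟨ *-monoˡ-≤ 0≤energy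
             (S³.∑-mono-≤ (λ { (y , y′ , s) → *-monoʳ-≤ (0≤sq (M y y′ s)) (w≤e₁e₁ y y′ s) })) ⟩
      energy * Q ∎
      where
      open ≤-Reasoning
      w≤e₁e₁ : ∀ y y′ s → w y y′ s ≤ e₁ (s ⊖ y) * e₁ (s ⊖ y′)
      w≤e₁e₁ y y′ s = *-mono-≤ (χ-nonNeg (A (s ⊖ y) y)) (χ-nonNeg (A (s ⊖ y′) y′))
                               (a≤e₁ (s ⊖ y) y) (a≤e₁ (s ⊖ y′) y′)

    colProd : Fin N → Fin N → ℚ
    colProd y y′ = Σ N (λ x → F x y * F x y′)

    rowProd : Fin N → Fin N → ℚ
    rowProd x x′ = Σ N (λ y → F x y * F x′ y)

    □ : ℚ
    □ = Σ N (λ y → Σ N (λ y′ → sq (colProd y y′)))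

    R₁ : ℚ
    R₁ = Σ N λ y → Σ N λ y′ → sq (colProd y y′) * ρ₁ (y′ ⊖ y)

    R₂ : ℚ
    R₂ = Σ N λ x → Σ N λ x′ → sq (rowProd x x′) * ρ₂ (x′ ⊖ x)

    M̃ : Fin N → Fin N → Fin N → ℚ
    M̃ y y′ s = Σ N (λ x → φ₂ (s ⊖ x) * (F x y * F x y′))

    M≡β₂colProd+M̃ : ∀ y y′ s → M y y′ s ≡ β₂ * colProd y y′ + M̃ y y′ s
    M≡β₂colProd+M̃ y y′ s = begin
      M y y′ s
        ≡⟨ Σ-cong N (λ x → split (e₂ (s ⊖ x)) β₂ (F x y * F x y′)) ⟩
      Σ N (λ x → β₂ * (F x y * F x y′) + φ₂ (s ⊖ x) * (F x y * F x y′))  ≡⟨ Σ-distrib-+ N _ _ ⟩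
      Σ N (λ x → β₂ * (F x y * F x y′)) + M̃ y y′ s               ≡⟨ cong (_+ M̃ y y′ s) (*-distribˡ-Σ N β₂ _) ⟩
      β₂ * colProd y y′ + M̃ y y′ s                               ∎
      where
      open ≡-Reasoning
      split : ∀ e b f → e * f ≡ b * f + (e - b) * f
      split = solve-∀ ℚ-ring

    Σe₁e₁colProd²≡ : S³.∑ (λ { (y , y′ , s) → (e₁ (s ⊖ y) * e₁ (s ⊖ y′)) * sq (colProd y y′) })
                     ≡ β₁ * β₁ * ι N * □ + R₁
    Σe₁e₁colProd²≡ = begin
      S³.∑ (λ { (y , y′ , s) → (e₁ (s ⊖ y) * e₁ (s ⊖ y′)) * sq (colProd y y′) })
        ≡⟨ S².∑-cong (λ { (y , y′) → S¹.*-distribʳ-∑ (sq (colProd y y′)) (λ s → e₁ (s ⊖ y) * e₁ (s ⊖ y′)) }) ⟩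
      S².∑ (λ { (y , y′) → Σ N (λ s → e₁ (s ⊖ y) * e₁ (s ⊖ y′)) * sq (colProd y y′) })
        ≡⟨ S².∑-cong (λ { (y , y′) → cong (_* sq (colProd y y′))
                                          (trans (Σ-correlation-shift e₁ e₁ y y′) (Σe₁e₁≡β₁²N+ρ₁ (y′ ⊖ y))) }) ⟩
      S².∑ (λ { (y , y′) → (β₁ * β₁ * ι N + ρ₁ (y′ ⊖ y)) * sq (colProd y y′) })
        ≡⟨ S².∑-cong (λ { (y , y′) → *-distribʳ-+ (sq (colProd y y′)) (β₁ * β₁ * ι N) (ρ₁ (y′ ⊖ y)) }) ⟩
      S².∑ (λ { (y , y′) → β₁ * β₁ * ι N * sq (colProd y y′) + ρ₁ (y′ ⊖ y) * sq (colProd y y′) })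
        ≡⟨ S².∑-distrib-+ _ _ ⟩
      S².∑ (λ { (y , y′) → β₁ * β₁ * ι N * sq (colProd y y′) })
        + S².∑ (λ { (y , y′) → ρ₁ (y′ ⊖ y) * sq (colProd y y′) })
        ≡⟨ cong₂ _+_ (S².*-distribˡ-∑ (β₁ * β₁ * ι N) (λ { (y , y′) → sq (colProd y y′) }))
                     (S².∑-cong (λ { (y , y′) → *-comm (ρ₁ (y′ ⊖ y)) (sq (colProd y y′)) })) ⟩
      β₁ * β₁ * ι N * □ + R₁ ∎
      where open ≡-Reasoning

    ΣM̃²≡R₂ : S³.∑ (λ { (y , y′ , s) → sq (M̃ y y′ s) }) ≡ R₂
    ΣM̃²≡R₂ = begin
      S³.∑ (λ { (y , y′ , s) → sq (M̃ y y′ s) })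
        ≡⟨ S³.∑-cong (λ { (y , y′ , s) → S¹.sq-∑ (m y y′ s) }) ⟩
      S³.∑ (λ { (y , y′ , s) → S².∑ (λ { (x , x′) → K x x′ y y′ s }) })
        ≡⟨ S².∑-cong (λ { (y , y′) → S².Σ-comm-∑ N (λ s → λ { (x , x′) → K x x′ y y′ s }) }) ⟩
      Σ N (λ y → Σ N (λ y′ → S².∑ (λ { (x , x′) → Σ N (K x x′ y y′) })))
        ≡⟨ Σ-cong N (λ y → S².Σ-comm-∑ N (λ y′ → λ { (x , x′) → Σ N (K x x′ y y′) })) ⟩
      Σ N (λ y → S².∑ (λ { (x , x′) → Σ N (λ y′ → Σ N (K x x′ y y′)) }))
        ≡⟨ S².Σ-comm-∑ N (λ y → λ { (x , x′) → Σ N (λ y′ → Σ N (K x x′ y y′)) }) ⟩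
      S².∑ (λ { (x , x′) → Σ N (λ y → Σ N (λ y′ → Σ N (K x x′ y y′))) })
        ≡⟨ S².∑-cong (λ { (x , x′) → Σ-cong N (λ y → Σ-cong N (λ y′ → ΣK x x′ y y′)) }) ⟩
      S².∑ (λ { (x , x′) → Σ N (λ y → Σ N (λ y′ → (F x y * F x′ y) * (F x y′ * F x′ y′) * ρ₂ (x′ ⊖ x))) })
        ≡⟨ S².∑-cong (λ { (x , x′) → trans (Σ-cong N (λ y → S¹.*-distribʳ-∑ (ρ₂ (x′ ⊖ x)) _))
                                             (S¹.*-distribʳ-∑ (ρ₂ (x′ ⊖ x)) _) }) ⟩
      S².∑ (λ { (x , x′) → Σ N (λ y → Σ N (λ y′ → (F x y * F x′ y) * (F x y′ * F x′ y′))) * ρ₂ (x′ ⊖ x) })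
        ≡⟨ S².∑-cong (λ { (x , x′) → cong (_* ρ₂ (x′ ⊖ x)) (S¹.sq-∑ (λ y → F x y * F x′ y)) }) ⟨
      R₂ ∎
      where
      open ≡-Reasoning
      m : Fin N → Fin N → Fin N → Fin N → ℚ
      m y y′ s x = φ₂ (s ⊖ x) * (F x y * F x y′)
      K : Fin N → Fin N → Fin N → Fin N → Fin N → ℚ
      K x x′ y y′ s = m y y′ s x * m y y′ s x′
      regroup : ∀ p f g q h k → (p * (f * g)) * (q * (h * k)) ≡ ((f * h) * (g * k)) * (p * q)
      regroup = solve-∀ ℚ-ring
      ΣK : ∀ x x′ y y′ → Σ N (K x x′ y y′) ≡ (F x y * F x′ y) * (F x y′ * F x′ y′) * ρ₂ (x′ ⊖ x)
      ΣK x x′ y y′ = begin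
        Σ N (K x x′ y y′)
          ≡⟨ Σ-cong N (λ s → regroup (φ₂ (s ⊖ x)) (F x y) (F x y′) (φ₂ (s ⊖ x′)) (F x′ y) (F x′ y′)) ⟩
        Σ N (λ s → (F x y * F x′ y) * (F x y′ * F x′ y′) * (φ₂ (s ⊖ x) * φ₂ (s ⊖ x′)))
          ≡⟨ *-distribˡ-Σ N ((F x y * F x′ y) * (F x y′ * F x′ y′)) (λ s → φ₂ (s ⊖ x) * φ₂ (s ⊖ x′)) ⟩
        (F x y * F x′ y) * (F x y′ * F x′ y′) * Σ N (λ s → φ₂ (s ⊖ x) * φ₂ (s ⊖ x′))
          ≡⟨ cong ((F x y * F x′ y) * (F x y′ * F x′ y′) *_) (Σ-correlation-shift φ₂ φ₂ x x′) ⟩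
        (F x y * F x′ y) * (F x y′ * F x′ y′) * ρ₂ (x′ ⊖ x) ∎

    Q≤ : Q ≤ 2ℚ * (β₂ * β₂) * (β₁ * β₁ * ι N * □ + R₁) + 2ℚ * R₂
    Q≤ = begin
      Q
        ≤⟨ S³.∑-mono-≤ (λ { (y , y′ , s) →
             pointwise (e₁ (s ⊖ y) * e₁ (s ⊖ y′)) β₂ (colProd y y′) (M̃ y y′ s) (M y y′ s)
                       (0≤e₁e₁ y y′ s) (e₁e₁≤1 y y′ s) (M≡β₂colProd+M̃ y y′ s) }) ⟩
      S³.∑ (λ { (y , y′ , s) → 2ℚ * (β₂ * β₂) * ((e₁ (s ⊖ y) * e₁ (s ⊖ y′)) * sq (colProd y y′))
                                + 2ℚ * sq (M̃ y y′ s) })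
        ≡⟨ S³.∑-distrib-+ _ _ ⟩
      S³.∑ (λ { (y , y′ , s) → 2ℚ * (β₂ * β₂) * ((e₁ (s ⊖ y) * e₁ (s ⊖ y′)) * sq (colProd y y′)) })
        + S³.∑ (λ { (y , y′ , s) → 2ℚ * sq (M̃ y y′ s) })
        ≡⟨ cong₂ _+_ (S³.*-distribˡ-∑ (2ℚ * (β₂ * β₂)) _) (S³.*-distribˡ-∑ 2ℚ _) ⟩
      2ℚ * (β₂ * β₂) * S³.∑ (λ { (y , y′ , s) → (e₁ (s ⊖ y) * e₁ (s ⊖ y′)) * sq (colProd y y′) })
        + 2ℚ * S³.∑ (λ { (y , y′ , s) → sq (M̃ y y′ s) })
        ≡⟨ cong₂ (λ u v → 2ℚ * (β₂ * β₂) * u + 2ℚ * v) Σe₁e₁colProd²≡ ΣM̃²≡R₂ ⟩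
      2ℚ * (β₂ * β₂) * (β₁ * β₁ * ι N * □ + R₁) + 2ℚ * R₂ ∎
      where
      open ≤-Reasoning
      0≤e₁e₁ : ∀ y y′ s → 0ℚ ≤ e₁ (s ⊖ y) * e₁ (s ⊖ y′)
      0≤e₁e₁ y y′ s = 0≤* (χ-nonNeg (E₁ (s ⊖ y))) (χ-nonNeg (E₁ (s ⊖ y′)))
      e₁e₁≤1 : ∀ y y′ s → e₁ (s ⊖ y) * e₁ (s ⊖ y′) ≤ 1ℚ
      e₁e₁≤1 y y′ s = ≤-trans (*-mono-≤ (χ-nonNeg (E₁ (s ⊖ y))) (χ-nonNeg (E₁ (s ⊖ y′)))
                                         (χ-≤1 (E₁ (s ⊖ y))) (χ-≤1 (E₁ (s ⊖ y′))))
                               (≤-reflexive (*-identityˡ 1ℚ))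
      pointwise : ∀ e b x m M → 0ℚ ≤ e → e ≤ 1ℚ → M ≡ b * x + m →
                  e * sq M ≤ 2ℚ * (b * b) * (e * sq x) + 2ℚ * sq m
      pointwise e b x m M 0≤e e≤1 refl = begin
        e * sq (b * x + m)                           ≤⟨ *-monoˡ-≤ 0≤e (sq-+-≤ (b * x) m) ⟩
        e * (2ℚ * sq (b * x) + 2ℚ * sq m)            ≡⟨ expand e b x m ⟩
        2ℚ * (b * b) * (e * sq x) + e * (2ℚ * sq m)  ≤⟨ +-monoʳ-≤ (2ℚ * (b * b) * (e * sq x)) (*-monoʳ-≤ 0≤2m² e≤1) ⟩
        2ℚ * (b * b) * (e * sq x) + 1ℚ * (2ℚ * sq m) ≡⟨ cong (2ℚ * (b * b) * (e * sq x) +_) (*-identityˡ _) ⟩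
        2ℚ * (b * b) * (e * sq x) + 2ℚ * sq m        ∎
        where
        0≤2m² : 0ℚ ≤ 2ℚ * sq m
        0≤2m² = 0≤* {2ℚ} (≤ᵇ⇒≤ _) (0≤sq m)
        expand : ∀ e b x m → e * (2ℚ * ((b * x) * (b * x)) + 2ℚ * (m * m))
                             ≡ 2ℚ * (b * b) * (e * (x * x)) + e * (2ℚ * (m * m))
        expand = solve-∀ ℚ-ring

    module _ (F²≤ν : ∀ x y → sq (F x y) ≤ ν x y) where

      R₁²≤ : sq R₁ ≤ (Σ N e₁ ^ℚ 4 * sq (Σ N e₂)) * (Σ N (λ k → sq (ρ₁ k)) * ι N)
      R₁²≤ = Σ-gram-correlation-bound F E₁ E₂ ρ₁ F²≤ν

      R₂²≤ : sq R₂ ≤ (Σ N e₂ ^ℚ 4 * sq (Σ N e₁)) * (Σ N (λ k → sq (ρ₂ k)) * ι N)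
      R₂²≤ = Σ-gram-correlation-bound (λ y x → F x y) E₂ E₁ ρ₂
               (λ y x → subst (sq (F x y) ≤_) (*-comm (e₁ x) (e₂ y)) (F²≤ν x y))

      module _ {d γ : ℚ} (0≤d : 0ℚ ≤ d) where

        R₁≤ : Σ N (λ k → sq (ρ₁ k)) ≤ γ * ι N ^ℚ 3 → γ ≤ sq (tenNeg 4) * β₁ ^ℚ 4 * β₂ ^ℚ 2 * d ^ℚ 16 →
              R₁ ≤ tenNeg 4 * d ^ℚ 8 * (β₁ ^ℚ 4 * sq β₂) * ι N ^ℚ 5
        R₁≤ U≤ γ≤ = correlation-term-bound (0≤ι N) 0≤β₁ 0≤β₂ 0≤k
          (subst₂ (λ p q → sq R₁ ≤ (p ^ℚ 4 * sq q) * (Σ N (λ k → sq (ρ₁ k)) * ι N)) Σe₁≡β₁N Σe₂≡β₂N R₁²≤)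
          U≤ (≤-trans (*-monoˡ-≤ (0≤* (^ℚ-nonNeg 4 0≤β₁) (0≤sq β₂)) γ≤)
                      (≤-reflexive (square (tenNeg 4) d β₁ β₂)))
          where
          0≤k : 0ℚ ≤ tenNeg 4 * d ^ℚ 8 * (β₁ ^ℚ 4 * sq β₂)
          0≤k = 0≤* (0≤* (0≤frac 1 (10 ^ 4)) (^ℚ-nonNeg 8 0≤d)) (0≤* (^ℚ-nonNeg 4 0≤β₁) (0≤sq β₂))
          square : ∀ c d b₁ b₂ → b₁ ^ℚ 4 * sq b₂ * (sq c * b₁ ^ℚ 4 * b₂ ^ℚ 2 * d ^ℚ 16)
                                 ≡ sq (c * d ^ℚ 8 * (b₁ ^ℚ 4 * sq b₂))
          square = solve 4 (λ c d b₁ b₂ → b₁ :^ 4 :* (b₂ :* b₂) :* ((c :* c) :* b₁ :^ 4 :* b₂ :^ 2 :* d :^ 16)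
                                          := (c :* d :^ 8 :* (b₁ :^ 4 :* (b₂ :* b₂)))
                                             :* (c :* d :^ 8 :* (b₁ :^ 4 :* (b₂ :* b₂)))) refl

        R₂≤ : Σ N (λ k → sq (ρ₂ k)) ≤ γ * ι N ^ℚ 3 → γ ≤ sq (tenNeg 4) * β₁ ^ℚ 6 * β₂ ^ℚ 4 * d ^ℚ 16 →
              R₂ ≤ tenNeg 4 * d ^ℚ 8 * (β₁ ^ℚ 4 * β₂ ^ℚ 4) * ι N ^ℚ 5
        R₂≤ U≤ γ≤ = correlation-term-bound (0≤ι N) 0≤β₂ 0≤β₁ 0≤k
          (subst₂ (λ p q → sq R₂ ≤ (q ^ℚ 4 * sq p) * (Σ N (λ k → sq (ρ₂ k)) * ι N)) Σe₁≡β₁N Σe₂≡β₂N R₂²≤)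
          U≤ (≤-trans (*-monoˡ-≤ (0≤* (^ℚ-nonNeg 4 0≤β₂) (0≤sq β₁)) γ≤)
                      (≤-reflexive (square (tenNeg 4) d β₁ β₂)))
          where
          0≤k : 0ℚ ≤ tenNeg 4 * d ^ℚ 8 * (β₁ ^ℚ 4 * β₂ ^ℚ 4)
          0≤k = 0≤* (0≤* (0≤frac 1 (10 ^ 4)) (^ℚ-nonNeg 8 0≤d)) (0≤* (^ℚ-nonNeg 4 0≤β₁) (^ℚ-nonNeg 4 0≤β₂))
          square : ∀ c d b₁ b₂ → b₂ ^ℚ 4 * sq b₁ * (sq c * b₁ ^ℚ 6 * b₂ ^ℚ 4 * d ^ℚ 16)
                                 ≡ sq (c * d ^ℚ 8 * (b₁ ^ℚ 4 * b₂ ^ℚ 4))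
          square = solve 4 (λ c d b₁ b₂ → b₂ :^ 4 :* (b₁ :* b₁) :* ((c :* c) :* b₁ :^ 6 :* b₂ :^ 4 :* d :^ 16)
                                          := (c :* d :^ 8 :* (b₁ :^ 4 :* b₂ :^ 4)) :* (c :* d :^ 8 :* (b₁ :^ 4 :* b₂ :^ 4))) refl

      Λ-lower-bound : ∀ {δ α γ} → 0ℚ ≤ δ → ∣A∣ ≡ δ * (β₁ * ι N) * (β₂ * ι N) →
        □ ≤ α * sq (β₁ * ι N) * sq (β₂ * ι N) → α ≤ tenNeg 108 * δ ^ℚ 8 →
        Σ N (λ k → sq (ρ₁ k)) ≤ γ * ι N ^ℚ 3 → Σ N (λ k → sq (ρ₂ k)) ≤ γ * ι N ^ℚ 3 →
        γ ≤ sq (tenNeg 4) * β₁ ^ℚ 4 * β₂ ^ℚ 2 * δ ^ℚ 16 → γ ≤ sq (tenNeg 4) * β₁ ^ℚ 6 * β₂ ^ℚ 4 * δ ^ℚ 16 →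
        - (δ * energy * ¼) ≤ Λ F
      Λ-lower-bound {δ} 0≤δ ∣A∣≡ □≤ α≤ U₁≤ U₂≤ γ≤₁ γ≤₂ =
        fourth-moment-lower-bound {Y = Y} {Q = Q} {m = ∣A∣} (0<ι N) 0≤δ 0≤energy ∣A∣²≤N*energy Λ²≤∣A∣*Y Y²≤energy*Q
          (subst (λ m → ι N ^ℚ 3 * Q ≤ ¼ ^ℚ 4 * (δ ^ℚ 4 * m ^ℚ 4)) (sym ∣A∣≡)
            (Q-bound (0≤ι N) 0≤δ 0≤β₁ 0≤β₂ Q≤ □≤ α≤
                     (R₁≤ 0≤δ U₁≤ γ≤₁) (R₂≤ 0≤δ U₂≤ γ≤₂)))

  r : Fin N → ℚ
  r y = δ-row N E₁ A y

  0≤r : ∀ y → 0ℚ ≤ r y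
  0≤r y = 0≤frac _ (card N E₁)

  r≤1 : ∀ y → r y ≤ 1ℚ
  r≤1 y = frac≤1 _ (card N E₁) (subst₂ _≤_ (sym (card≡Σχ N (λ x → E₁ x ∧ A x y))) (sym (card≡Σχ N E₁))
    (Σ-mono-≤ N (λ x → subst (_≤ e₁ x) (sym (χ-∧ (E₁ x) (A x y)))
      (≤-trans (*-monoˡ-≤ (χ-nonNeg (E₁ x)) (χ-≤1 (A x y))) (≤-reflexive (*-identityʳ (e₁ x)))))))

  f : Fin N → Fin N → ℚ
  f = balanced N E₁ E₂ A

  h : ℚ → Fin N → Fin N → ℚ
  h δ x y = (r y - δ) * χ (E₁ x ∧ E₂ y)

  a≡f+h+δν : ∀ δ x y → a x y ≡ f x y + h δ x y + δ * ν x y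
  a≡f+h+δν δ x y = begin
    a x y                                                     ≡⟨ e₁*a≡a x y ⟨
    e₁ x * a x y                                              ≡⟨ cong (e₁ x *_) (e₂*a≡a x y) ⟨
    e₁ x * (e₂ y * a x y)                                     ≡⟨ telescope (a x y) (r y) δ (e₁ x) (e₂ y) ⟩
    (a x y - r y) * (e₁ x * e₂ y) + (r y - δ) * (e₁ x * e₂ y) + δ * ν x y
      ≡⟨ cong (λ c → (a x y - r y) * c + (r y - δ) * c + δ * ν x y) (χ-∧ (E₁ x) (E₂ y)) ⟨
    f x y + h δ x y + δ * ν x y                               ∎
    where
    open ≡-Reasoning
    telescope : ∀ a r d p q → p * (q * a) ≡ (a - r) * (p * q) + (r - d) * (p * q) + d * (p * q)
    telescope = solve-∀ ℚ-ring

  Λa≡Λf+Λh+δ*energy : ∀ δ → Λ a ≡ Λ f + Λ (h δ) + δ * energy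
  Λa≡Λf+Λh+δ*energy δ = begin
    Λ a                                                        ≡⟨ Λ-cong (a≡f+h+δν δ) ⟩
    Λ (λ x y → f x y + h δ x y + δ * ν x y)                    ≡⟨ Λ-+ (λ x y → f x y + h δ x y) (λ x y → δ * ν x y) ⟩
    Λ (λ x y → f x y + h δ x y) + Λ (λ x y → δ * ν x y)        ≡⟨ cong₂ _+_ (Λ-+ f (h δ)) (Λ-* δ ν) ⟩
    Λ f + Λ (h δ) + δ * Λ ν                                    ≡⟨ cong (λ t → Λ f + Λ (h δ) + δ * t) Λν≡energy ⟩
    Λ f + Λ (h δ) + δ * energy                                 ∎
    where open ≡-Reasoning

  sq-*χ∧≤ : ∀ u x y → sq u ≤ 1ℚ → sq (u * χ (E₁ x ∧ E₂ y)) ≤ ν x y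
  sq-*χ∧≤ u x y u²≤1 = begin
    sq (u * c)        ≡⟨ regroup u c ⟩
    sq u * (c * c)    ≡⟨ cong (sq u *_) (χ-idem (E₁ x ∧ E₂ y)) ⟩
    sq u * c          ≤⟨ *-monoʳ-≤ (χ-nonNeg (E₁ x ∧ E₂ y)) u²≤1 ⟩
    1ℚ * c            ≡⟨ trans (*-identityˡ c) (χ-∧ (E₁ x) (E₂ y)) ⟩
    ν x y             ∎
    where
    open ≤-Reasoning
    c = χ (E₁ x ∧ E₂ y)
    regroup : ∀ u c → (u * c) * (u * c) ≡ (u * u) * (c * c)
    regroup = solve-∀ ℚ-ring

  f²≤ν : ∀ x y → sq (f x y) ≤ ν x y
  f²≤ν x y = sq-*χ∧≤ (a x y - r y) x y (sq-diff≤1 (χ-nonNeg (A x y)) (χ-≤1 (A x y)) (0≤r y) (r≤1 y))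

  h²≤ν : ∀ {δ} → 0ℚ ≤ δ → δ ≤ 1ℚ → ∀ x y → sq (h δ x y) ≤ ν x y
  h²≤ν {δ} 0≤δ δ≤1 x y = sq-*χ∧≤ (r y - δ) x y (sq-diff≤1 (0≤r y) (r≤1 y) 0≤δ δ≤1)

  rowDeviation : ℚ → ℚ
  rowDeviation δ = Σ N (λ y → e₂ y * sq (r y - δ))

  □h≡ : ∀ δ → LowerBound.□ (h δ) ≡ sq (Σ N e₁) * sq (rowDeviation δ)
  □h≡ δ = begin
    Σ N (λ y → Σ N (λ y′ → sq (colProd y y′)))
      ≡⟨ Σ-cong N (λ y → Σ-cong N (λ y′ → cong sq (colProd≡ y y′))) ⟩
    Σ N (λ y → Σ N (λ y′ → sq (g y * g y′ * Σ N e₁)))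
      ≡⟨ Σ-cong N (λ y → Σ-cong N (λ y′ → regroup (g y) (g y′) (Σ N e₁))) ⟩
    Σ N (λ y → Σ N (λ y′ → sq (Σ N e₁) * (sq (g y) * sq (g y′))))
      ≡⟨ S².*-distribˡ-∑ (sq (Σ N e₁)) (λ { (y , y′) → sq (g y) * sq (g y′) }) ⟩
    sq (Σ N e₁) * Σ N (λ y → Σ N (λ y′ → sq (g y) * sq (g y′)))
      ≡⟨ cong (sq (Σ N e₁) *_) (S¹.sq-∑ (λ y → sq (g y))) ⟨
    sq (Σ N e₁) * sq (Σ N (λ y → sq (g y)))
      ≡⟨ cong (λ t → sq (Σ N e₁) * sq t) (Σ-cong N (λ y → trans (sq-g y) (cong (_* sq (r y - δ)) (χ-idem (E₂ y))))) ⟩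
    sq (Σ N e₁) * sq (rowDeviation δ) ∎
    where
    open ≡-Reasoning
    open LowerBound (h δ) using (colProd)
    g : Fin N → ℚ
    g y = (r y - δ) * e₂ y
    colProd≡ : ∀ y y′ → colProd y y′ ≡ g y * g y′ * Σ N e₁
    colProd≡ y y′ = trans (Σ-cong N (λ x → trans
        (cong₂ (λ u v → ((r y - δ) * u) * ((r y′ - δ) * v)) (χ-∧ (E₁ x) (E₂ y)) (χ-∧ (E₁ x) (E₂ y′)))
        (trans (regroup′ (r y - δ) (r y′ - δ) (e₁ x) (e₂ y) (e₂ y′)) (cong (g y * g y′ *_) (χ-idem (E₁ x))))))
      (*-distribˡ-Σ N (g y * g y′) e₁)
      where
      regroup′ : ∀ u v p q q′ → (u * (p * q)) * (v * (p * q′)) ≡ (u * q) * (v * q′) * (p * p)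
      regroup′ = solve-∀ ℚ-ring
    regroup : ∀ u v n → (u * v * n) * (u * v * n) ≡ (n * n) * ((u * u) * (v * v))
    regroup = solve-∀ ℚ-ring
    sq-g : ∀ y → sq (g y) ≡ (e₂ y * e₂ y) * sq (r y - δ)
    sq-g y = regroup″ (r y - δ) (e₂ y)
      where
      regroup″ : ∀ u e → (u * e) * (u * e) ≡ (e * e) * (u * u)
      regroup″ = solve-∀ ℚ-ring

  □h≤ : ∀ {δ α} → 0ℚ ≤ α → α ≤ 1ℚ → rowDeviation δ ≤ α * β₂ * ι N →
        LowerBound.□ (h δ) ≤ α * sq (β₁ * ι N) * sq (β₂ * ι N)
  □h≤ {δ} {α} 0≤α α≤1 dev≤ = begin
    LowerBound.□ (h δ)                              ≡⟨ □h≡ δ ⟩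
    sq (Σ N e₁) * sq (rowDeviation δ)               ≤⟨ *-monoˡ-≤ (0≤sq (Σ N e₁)) (sq-mono-≤ 0≤dev dev≤) ⟩
    sq (Σ N e₁) * sq (α * β₂ * ι N)                 ≡⟨ cong (λ t → sq t * sq (α * β₂ * ι N)) Σe₁≡β₁N ⟩
    sq (β₁ * ι N) * sq (α * β₂ * ι N)               ≡⟨ regroup α (β₁ * ι N) β₂ (ι N) ⟩
    (α * sq (β₁ * ι N) * sq (β₂ * ι N)) * α         ≤⟨ *-monoˡ-≤ 0≤α∣E₁∣²∣E₂∣² α≤1 ⟩
    (α * sq (β₁ * ι N) * sq (β₂ * ι N)) * 1ℚ        ≡⟨ *-identityʳ _ ⟩
    α * sq (β₁ * ι N) * sq (β₂ * ι N)               ∎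
    where
    open ≤-Reasoning
    0≤α∣E₁∣²∣E₂∣² : 0ℚ ≤ α * sq (β₁ * ι N) * sq (β₂ * ι N)
    0≤α∣E₁∣²∣E₂∣² = 0≤* (0≤* 0≤α (0≤sq (β₁ * ι N))) (0≤sq (β₂ * ι N))
    0≤dev : 0ℚ ≤ rowDeviation δ
    0≤dev = S¹.∑-nonNeg (λ y → 0≤* (χ-nonNeg (E₂ y)) (0≤sq (r y - δ)))
    regroup : ∀ α p b n → (p * p) * ((α * b * n) * (α * b * n)) ≡ (α * (p * p) * ((b * n) * (b * n))) * α
    regroup = solve-∀ ℚ-ring

  ∣A∣≡ι∣A∣ : ∣A∣ ≡ ι (card₂ N A)
  ∣A∣≡ι∣A∣ = sym (trans (ι-Σℕ N (λ x → card N (A x))) (Σ-cong N (λ x → card≡Σχ N (A x))))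

  ∣A∣≤∣E₁∣∣E₂∣ : ∣A∣ ≤ Σ N e₁ * Σ N e₂
  ∣A∣≤∣E₁∣∣E₂∣ = begin
    ∣A∣                                    ≤⟨ S².∑-mono-≤ (λ { (x , y) → a≤ν x y }) ⟩
    Σ N (λ x → Σ N (λ y → e₁ x * e₂ y))    ≡⟨ Σ-cong N (λ x → *-distribˡ-Σ N (e₁ x) e₂) ⟩
    Σ N (λ x → e₁ x * Σ N e₂)              ≡⟨ S¹.*-distribʳ-∑ (Σ N e₂) e₁ ⟩
    Σ N e₁ * Σ N e₂                        ∎
    where open ≤-Reasoning

  half-energy≤∣A∣ : ∀ {δ} → ¬ HasCorner N A →
    - (δ * energy * ¼) ≤ Λ f → - (δ * energy * ¼) ≤ Λ (h δ) → δ * energy * ½ ≤ ∣A∣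
  half-energy≤∣A∣ {δ} noCorner Λf≥ Λh≥ = begin
    δ * energy * ½                                        ≡⟨ split (δ * energy) ⟩
    - (δ * energy * ¼) + - (δ * energy * ¼) + δ * energy  ≤⟨ +-monoˡ-≤ (δ * energy) (+-mono-≤ Λf≥ Λh≥) ⟩
    Λ f + Λ (h δ) + δ * energy                            ≡⟨ Λa≡Λf+Λh+δ*energy δ ⟨
    Λ a                                                   ≡⟨ Λa≡∣A∣ noCorner ⟩
    ∣A∣                                                   ∎
    where
    open ≤-Reasoning
    split : ∀ p → p * ½ ≡ - (p * ¼) + - (p * ¼) + p
    split = solve-∀ ℚ-ring

  ι∣E₁∣≡β₁N : ι (card N E₁) ≡ β₁ * ι N
  ι∣E₁∣≡β₁N = trans (card≡Σχ N E₁) Σe₁≡β₁N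

  ι∣E₂∣≡β₂N : ι (card N E₂) ≡ β₂ * ι N
  ι∣E₂∣≡β₂N = trans (card≡Σχ N E₂) Σe₂≡β₂N

  ∣A∣≡δ∣E₁∣∣E₂∣ : ∀ {δ} → ι (card₂ N A) ≡ δ * ι (card N E₁) * ι (card N E₂) →
                  ∣A∣ ≡ δ * (β₁ * ι N) * (β₂ * ι N)
  ∣A∣≡δ∣E₁∣∣E₂∣ {δ} ι∣A∣≡ =
    trans ∣A∣≡ι∣A∣ (trans ι∣A∣≡ (cong₂ (λ p q → δ * p * q) ι∣E₁∣≡β₁N ι∣E₂∣≡β₂N))

  δ≤1 : ∀ {δ} → ∣A∣ ≡ δ * (β₁ * ι N) * (β₂ * ι N) → 0ℚ < (β₁ * ι N) * (β₂ * ι N) → δ ≤ 1ℚ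
  δ≤1 {δ} ∣A∣≡ 0<∣E₁∣∣E₂∣ = *-cancelʳ-≤ 0<∣E₁∣∣E₂∣ (begin
    δ * ((β₁ * ι N) * (β₂ * ι N))       ≡⟨ trans ∣A∣≡ (*-assoc δ (β₁ * ι N) (β₂ * ι N)) ⟨
    ∣A∣                                  ≤⟨ ∣A∣≤∣E₁∣∣E₂∣ ⟩
    Σ N e₁ * Σ N e₂                      ≡⟨ trans (cong₂ _*_ Σe₁≡β₁N Σe₂≡β₂N) (sym (*-identityˡ _)) ⟩
    1ℚ * ((β₁ * ι N) * (β₂ * ι N))       ∎)
    where open ≤-Reasoning

  corner-free-impossible : ∀ {β₁′ β₂′ δ} → β₁ ≡ β₁′ → β₂ ≡ β₂′ →
    ι (card₂ N A) ≡ δ * ι (card N E₁) * ι (card N E₂) → 0ℚ < δ →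
    IsUniformSet N E₁ (tenNeg 330 * (β₁′ ^ℚ 24) * (β₂′ ^ℚ 24) * (δ ^ℚ 132)) →
    IsUniformSet N E₂ (tenNeg 330 * (β₁′ ^ℚ 24) * (β₂′ ^ℚ 24) * (δ ^ℚ 132)) →
    IsUniformWrtBasis N E₁ E₂ A (tenNeg 108 * (δ ^ℚ 44)) →
    ι (10 ^ 10) ≤ ι N * ((δ ^ℚ 4) * β₁′ * β₂′) →
    rowDeviation δ ≤ tenNeg 108 * (δ ^ℚ 44) * β₂′ * ι N →
    ¬ HasCorner N A → ⊥
  corner-free-impossible {δ = δ} refl refl ι∣A∣≡ 0<δ E₁-uniform E₂-uniform A-uniform N-large row≤ noCorner =
    large-N-contradiction (0<ι N) 0≤δ δ≤1′ ∣A∣≡ ∣A∣²≤N*energy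
      (half-energy≤∣A∣ noCorner (Λ≥ f f²≤ν □f≤) (Λ≥ (h δ) (h²≤ν 0≤δ δ≤1′) (□h≤ 0≤α α≤1 row≤)))
      N-large
    where
    0≤δ = <⇒≤ 0<δ
    ∣A∣≡ = ∣A∣≡δ∣E₁∣∣E₂∣ {δ} ι∣A∣≡
    δ≤1′ = δ≤1 {δ} ∣A∣≡ (large-N⇒0<b₁n*b₂n (0<ι N) 0≤δ N-large)
    α = tenNeg 108 * (δ ^ℚ 44)
    0≤α : 0ℚ ≤ α
    0≤α = 0≤* (0≤frac 1 (10 ^ 108)) (^ℚ-nonNeg 44 0≤δ)
    α≤1 : α ≤ 1ℚ
    α≤1 = ≤-trans (*-mono-≤ (0≤frac 1 (10 ^ 108)) (^ℚ-nonNeg 44 0≤δ) 10⁻¹⁰⁸≤1 (^ℚ-≤1 44 0≤δ δ≤1′))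
                  (≤-reflexive (*-identityˡ 1ℚ))
      where
      10⁻¹⁰⁸≤1 : tenNeg 108 ≤ 1ℚ
      10⁻¹⁰⁸≤1 = ≤ᵇ⇒≤ _
    α≤ : α ≤ tenNeg 108 * δ ^ℚ 8
    α≤ = *-monoˡ-≤ (0≤frac 1 (10 ^ 108)) (^ℚ-antimono (ℕ.≤ᵇ⇒≤ 8 44 _) 0≤δ δ≤1′)
    γ = tenNeg 330 * (β₁ ^ℚ 24) * (β₂ ^ℚ 24) * (δ ^ℚ 132)
    γ≤ : ∀ i j → i ℕ.≤ 24 → j ℕ.≤ 24 → γ ≤ sq (tenNeg 4) * β₁ ^ℚ i * β₂ ^ℚ j * δ ^ℚ 16
    γ≤ i j i≤24 j≤24 = uniformity-constant-bound i j i≤24 j≤24 0≤β₁ β₁≤1 0≤β₂ β₂≤1 0≤δ δ≤1′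
    □f≤ : LowerBound.□ f ≤ α * sq (β₁ * ι N) * sq (β₂ * ι N)
    □f≤ = subst₂ (λ p q → LowerBound.□ f ≤ α * sq p * sq q) ι∣E₁∣≡β₁N ι∣E₂∣≡β₂N A-uniform
    Λ≥ : ∀ F → (∀ x y → sq (F x y) ≤ ν x y) → LowerBound.□ F ≤ α * sq (β₁ * ι N) * sq (β₂ * ι N) →
         - (δ * energy * ¼) ≤ Λ F
    Λ≥ F F²≤ν □≤ = LowerBound.Λ-lower-bound F F²≤ν 0≤δ ∣A∣≡ □≤ α≤
      (subst (λ t → Σ N (λ k → sq (ρ₁ k)) ≤ γ * t) (ι-^ N 3) E₁-uniform)
      (subst (λ t → Σ N (λ k → sq (ρ₂ k)) ≤ γ * t) (ι-^ N 3) E₂-uniform)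
      (γ≤ 4 2 (ℕ.≤ᵇ⇒≤ 4 24 _) (ℕ.≤ᵇ⇒≤ 2 24 _)) (γ≤ 6 4 (ℕ.≤ᵇ⇒≤ 6 24 _) (ℕ.≤ᵇ⇒≤ 4 24 _))

hasCorner? : ∀ N .{{_ : NonZero N}} (A : Fin N → Fin N → Bool) → Dec (HasCorner N A)
hasCorner? N A = any? λ a → any? λ b → any? λ d →
  ¬? (toℕ d ℕ.≟ 0) ×-dec
  (A a b Bool.≟ true ×-dec (A (_+ₙ_ N a d) b Bool.≟ true ×-dec A a (_+ₙ_ N b d) Bool.≟ true))

theorem3p9 :
    (N : ℕ) .{{_ : NonZero N}} →
    (E₁ E₂ : Fin N → Bool) → (A : Fin N → Fin N → Bool) →
    (β₁ β₂ δ : ℚ) →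
    ι (card N E₁) ≡ β₁ * ι N →
    ι (card N E₂) ≡ β₂ * ι N →
    (∀ x y → A x y ≡ true → (E₁ x ≡ true) × (E₂ y ≡ true)) →
    ι (card₂ N A) ≡ δ * ι (card N E₁) * ι (card N E₂) →
    0ℚ < δ →
    IsUniformSet N E₁ (tenNeg 330 * (β₁ ^ℚ 24) * (β₂ ^ℚ 24) * (δ ^ℚ 132)) →
    IsUniformSet N E₂ (tenNeg 330 * (β₁ ^ℚ 24) * (β₂ ^ℚ 24) * (δ ^ℚ 132)) →
    IsUniformWrtBasis N E₁ E₂ A (tenNeg 108 * (δ ^ℚ 44)) →
    ι (10 ^ 10) ≤ ι N * ((δ ^ℚ 4) * β₁ * β₂) →
    Σ N (λ y → χ (E₂ y) * sq (δ-row N E₁ A y - δ))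
      ≤ tenNeg 108 * (δ ^ℚ 44) * β₂ * ι N →
    HasCorner N A
theorem3p9 N E₁ E₂ A β₁ β₂ δ ∣E₁∣≡β₁N ∣E₂∣≡β₂N A⊆E₁×E₂ ∣A∣≡ 0<δ
           E₁-uniform E₂-uniform A-uniform N-large rows-balanced =
  decidable-stable (hasCorner? N A) (Corners.corner-free-impossible N E₁ E₂ A A⊆E₁×E₂
    (Autocorrelation.density-unique N E₁ ∣E₁∣≡β₁N) (Autocorrelation.density-unique N E₂ ∣E₂∣≡β₂N)
    ∣A∣≡ 0<δ E₁-uniform E₂-uniform A-uniform N-large rows-balanced)
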